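{- Let $n\ge 6$ be even and let $P(n)$ be the number of normal Latin rows of length $n$ with maximum inner distance (equivalently, Hamiltonian paths starting at vertex $1$ in the graph on $[1,n]$ whose edges join symbols at distance at least $\frac n2-1$). If $n=4k$ then $P(n)=\frac14n^2+2=4k^2+2$; if $n=4k+2$ then $P(n)=\frac14 n^2+1=4k^2+4k+2$.
   Context: For $a,b\in[1,n]$, $\mathrm{dist}(a,b)$ is the minimum of the residues in $[0,n-1]$ of $a-b$ and $b-a$ modulo $n$. A Latin row of length $n$ is a permutation $(s_1,\dots,s_n)$ of $[1,n]$; it is normal if $s_1=1$, and has maximum inner distance if $\mathrm{dist}(s_j,s_{j+1})\geq \frac n2-1$ for all $1\le j\le n-1$. -}

module Defs where

open import Data.Nat using (ℕ; zero; suc; _+_; _*_; _∸_; _≤_; _⊓_)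
open import Data.Nat.DivMod using (_%_; _/_)
open import Data.List using (List; []; _∷_; map; upTo)
open import Data.List.Relation.Unary.Linked using (Linked)
open import Data.List.Relation.Binary.Permutation.Propositional using (_↭_)
open import Data.List.Relation.Unary.Unique.Propositional using (Unique)
open import Data.List.Membership.Propositional using (_∈_)
open import Relation.Binary.PropositionalEquality using (_≡_)
open import Data.Product using (_×_; ∃)

[1,_] : ℕ → List ℕ
[1, n ] = map suc (upTo n)

-- dist(a,b) = min of the residues in [0,n-1] of a-b and b-a modulo n
-- (a,b ∈ [1,n], so a + n ∸ b = a - b + n ≥ 1 is the right representative).
-- (n = 0 never occurs in the theorem; dist is set to 0 there only for totality)
dist : ℕ → ℕ → ℕ → ℕ
dist zero a b = 0
dist n@(suc _) a b = ((a + n ∸ b) % n) ⊓ ((b + n ∸ a) % n)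

LatinRow : ℕ → List ℕ → Set
LatinRow n s = s ↭ [1, n ]

Normal : List ℕ → Set
Normal [] = Data.Empty.⊥ where import Data.Empty
Normal (x ∷ _) = x ≡ 1

-- maximum inner distance: dist(s_j,s_{j+1}) ≥ n/2 - 1 for all consecutive pairs
-- (n is even in the theorem, so n / 2 is exact)
MaxInnerDist : (n : ℕ) → List ℕ → Set
MaxInnerDist n s = Linked (λ a b → n / 2 ∸ 1 ≤ dist n a b) s

GoodRow : (n : ℕ) → List ℕ → Set
GoodRow n s = LatinRow n s × Normal s × MaxInnerDist n s

CountIs : (n : ℕ) → ℕ → Set
CountIs n c = ∃ λ (L : List (List ℕ)) →
  Unique L × (∀ s → s ∈ L → GoodRow n s) × (∀ s → GoodRow n s → s ∈ L)
  × Data.List.length L ≡ c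

{-# OPTIONS --safe #-}
module Submission where

-- Joining symbols at distance h − 1, h or h + 1 (n = 2h) gives a cubic graph: a ladder whose columns are
-- the pairs {c + 1, h + c + 1}, with a rung in each column, steps between neighbouring columns and a wrap
-- from the last column back to the first.  Up to the reflection of the columns that fixes the symbol 1, a
-- Hamiltonian path from 1 first moves to column 1, either directly along a rail or after the rung of
-- column 0.  Such a path is forced into one of five shapes: after the first rung it sweeps the remaining
-- columns as a corridor; otherwise it runs along the rail to some column a, takes the rung there and then
-- either comes straight back (a = h − 1), or comes back, wraps, and sweeps the columns beyond a as a
-- corridor, or sweeps them as a full zigzag, wraps and comes back along the other rail (a even only), or
-- it never takes a rung and wraps once around the whole ladder (h even only).  These are
-- (h − 1) + (h − 1)(h − 2)/2 + 1 + ⌊(h − 1)/2⌋ + [h even] paths; doubling gives h² + 2 for even h and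
-- h² + 1 for odd h.

open import Defs
open import Data.Nat using (ℕ; zero; suc; _+_; _*_; _≤_; s≤s)
open import Data.Nat.Tactic.RingSolver using (solve-∀)
open import Data.Product using (_×_; _,_)
open import Relation.Binary.PropositionalEquality using (_≡_; subst₂)

module Basics where

  open import Data.Nat using (ℕ; zero; suc; _+_; _∸_; _<_; s≤s)
  open import Data.Nat.Properties
  open import Data.Bool using (true; false; not)
  open import Data.List using (List; []; _∷_; _++_; applyUpTo; applyDownFrom)
  open import Data.List.Properties using (∷-injective)
  open import Data.List.Membership.Propositional using (_∈_)
  open import Data.List.Membership.Propositional.Properties using (∈-++⁺ˡ; ∈-++⁻)
  open import Data.List.Relation.Binary.Disjoint.Propositional using (Disjoint)
  import Data.List.Relation.Unary.Unique.Propositional.Properties as Unique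
  open import Data.List.Relation.Unary.Any using (here; there)
  import Data.List.Relation.Unary.All as All
  open import Data.List.Relation.Unary.AllPairs using ([]; _∷_)
  open import Data.List.Relation.Unary.Linked using (Linked; []; [-]; _∷_)
  open import Data.List.Relation.Unary.Unique.Propositional using (Unique)
  open import Data.Product using (_×_; _,_; proj₁; proj₂)
  open import Data.Sum using (_⊎_; inj₁; inj₂)
  open import Data.Empty using (⊥; ⊥-elim)
  open import Relation.Binary.PropositionalEquality

  private variable
    V : Set
    A : V → V → Set

  not-≢ : ∀ r → not r ≢ r
  not-≢ true ()
  not-≢ false ()

  ≡∨≡not : ∀ r r₀ → r ≡ r₀ ⊎ r ≡ not r₀
  ≡∨≡not true true = inj₁ refl
  ≡∨≡not true false = inj₂ refl
  ≡∨≡not false true = inj₂ refl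
  ≡∨≡not false false = inj₁ refl

  mirror< : ∀ {t L} → t < L → L ∸ suc t < L
  mirror< {t} {suc L} (s≤s t≤L) = s≤s (m∸n≤m L t)

  mirror-involutive : ∀ {i L} → i < L → L ∸ suc (L ∸ suc i) ≡ i
  mirror-involutive {i} {suc L} (s≤s i≤L) = m∸[m∸n]≡n i≤L

  mirror-injective : ∀ {t t' L} → t < L → t' < L → L ∸ suc t ≡ L ∸ suc t' → t ≡ t'
  mirror-injective {t} {t'} {L} p q eq =
    trans (sym (mirror-involutive p)) (trans (cong (λ x → L ∸ suc x) eq) (mirror-involutive q))

  mirror-suc : ∀ {t t' L} → t < L → t' < L → L ∸ suc t' ≡ suc (L ∸ suc t) → t ≡ suc t'
  mirror-suc {t} {t'} {suc L} (s≤s p) (s≤s q) eq = +-cancelʳ-≡ (L ∸ t) t (suc t') (begin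
    t + (L ∸ t)        ≡⟨ m+[n∸m]≡n p ⟩
    L                  ≡⟨ sym (m+[n∸m]≡n q) ⟩
    t' + (L ∸ t')      ≡⟨ cong (t' +_) eq ⟩
    t' + suc (L ∸ t)   ≡⟨ +-suc t' (L ∸ t) ⟩
    suc t' + (L ∸ t)   ∎)
    where open ≡-Reasoning

  unique-head≢ : ∀ {x v : V} {l} → Unique (x ∷ l) → v ∈ l → x ≢ v
  unique-head≢ (px ∷ _) m = All.lookup px m

  unique-tail : ∀ {x : V} {l} → Unique (x ∷ l) → Unique l
  unique-tail (_ ∷ u) = u

  unique-++⁻ˡ : (xs ys : List V) → Unique (xs ++ ys) → Unique xs
  unique-++⁻ˡ [] ys u = []
  unique-++⁻ˡ (x ∷ xs) ys (px ∷ u) = All.tabulate (λ m → All.lookup px (∈-++⁺ˡ m)) ∷ unique-++⁻ˡ xs ys u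

  unique-++⁻ʳ : (xs ys : List V) → Unique (xs ++ ys) → Unique ys
  unique-++⁻ʳ [] ys u = u
  unique-++⁻ʳ (x ∷ xs) ys (_ ∷ u) = unique-++⁻ʳ xs ys u

  disjoint-by : {P Q : V → Set} {xs ys : List V} → (∀ v → v ∈ xs → P v) → (∀ v → v ∈ ys → Q v)
    → (∀ v → P v → Q v → ⊥) → Disjoint xs ys
  disjoint-by px qy pq (m₁ , m₂) = pq _ (px _ m₁) (qy _ m₂)

  unique-++ : {P Q : V → Set} {xs ys : List V} → Unique xs → Unique ys → (∀ v → v ∈ xs → P v)
    → (∀ v → v ∈ ys → Q v) → (∀ v → P v → Q v → ⊥) → Unique (xs ++ ys)
  unique-++ ux uy px qy pq = Unique.++⁺ ux uy (disjoint-by px qy pq)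

  ∈-++-by : {P Q : V → Set} (xs : List V) {ys : List V} → (∀ v → v ∈ xs → P v) → (∀ v → v ∈ ys → Q v)
    → ∀ v → v ∈ xs ++ ys → P v ⊎ Q v
  ∈-++-by xs px qy v m with ∈-++⁻ xs m
  ... | inj₁ m′ = inj₁ (px v m′)
  ... | inj₂ m′ = inj₂ (qy v m′)

  ∈-drop₂ : ∀ {v a b : V} {l} → v ∈ a ∷ b ∷ l → v ≢ a → v ≢ b → v ∈ l
  ∈-drop₂ (here eq) na nb = ⊥-elim (na eq)
  ∈-drop₂ (there (here eq)) na nb = ⊥-elim (nb eq)
  ∈-drop₂ (there (there m)) na nb = m

  linked-++⁻ˡ : (x : V) (xs ys : List V) → Linked A ((x ∷ xs) ++ ys) → Linked A (x ∷ xs)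
  linked-++⁻ˡ x [] ys l = [-]
  linked-++⁻ˡ x (y ∷ xs) ys (a ∷ l) = a ∷ linked-++⁻ˡ y xs ys l

  linked-++⁻ʳ : (xs ys : List V) → Linked A (xs ++ ys) → Linked A ys
  linked-++⁻ʳ [] ys l = l
  linked-++⁻ʳ (x ∷ []) [] l = []
  linked-++⁻ʳ (x ∷ []) (y ∷ ys) (a ∷ l) = l
  linked-++⁻ʳ (x ∷ z ∷ xs) ys (a ∷ l) = linked-++⁻ʳ (z ∷ xs) ys l

  linked-++-∷ : (xs : List V) {y z : V} {ys : List V} → Linked A (xs ++ y ∷ []) → A y z → Linked A (z ∷ ys)
    → Linked A (xs ++ y ∷ z ∷ ys)
  linked-++-∷ [] l₁ a l₂ = a ∷ l₂
  linked-++-∷ (w ∷ []) (b ∷ _) a l₂ = b ∷ a ∷ l₂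
  linked-++-∷ (w ∷ w' ∷ xs) (b ∷ l₁) a l₂ = b ∷ linked-++-∷ (w' ∷ xs) l₁ a l₂

  linked-applyUpTo-++ : (f : ℕ → V) (a : ℕ) (ys : List V) → Linked A (applyUpTo f (suc a)) → Linked A (f a ∷ ys)
    → Linked A (applyUpTo f a ++ f a ∷ ys)
  linked-applyUpTo-++ f zero ys l₁ l₂ = l₂
  linked-applyUpTo-++ f (suc zero) ys (b ∷ _) l₂ = b ∷ l₂
  linked-applyUpTo-++ f (suc (suc a)) ys (b ∷ l₁) l₂ = b ∷ linked-applyUpTo-++ (λ i → f (suc i)) (suc a) ys l₁ l₂

  linked-applyDownFrom-++ : (f : ℕ → V) (a : ℕ) (ys : List V) → Linked A (applyDownFrom f (suc a)) → Linked A (f 0 ∷ ys)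
    → Linked A (applyDownFrom f (suc a) ++ ys)
  linked-applyDownFrom-++ f zero ys l₁ l₂ = l₂
  linked-applyDownFrom-++ f (suc a) ys (b ∷ l₁) l₂ = b ∷ linked-applyDownFrom-++ f a ys l₁ l₂

  applyUpTo-cong : ∀ {f g : ℕ → V} n → (∀ i → f i ≡ g i) → applyUpTo f n ≡ applyUpTo g n
  applyUpTo-cong zero eq = refl
  applyUpTo-cong (suc n) eq = cong₂ _∷_ (eq 0) (applyUpTo-cong n (λ i → eq (suc i)))

  applyUpTo-∸≡applyDownFrom : (f : ℕ → V) (L : ℕ) → applyUpTo (λ t → f (L ∸ suc t)) L ≡ applyDownFrom f L
  applyUpTo-∸≡applyDownFrom f zero = refl
  applyUpTo-∸≡applyDownFrom f (suc L) = cong (f L ∷_) (applyUpTo-∸≡applyDownFrom f L)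

  applyUpTo-suc-++ : (f : ℕ → V) (a : ℕ) (l : List V) → applyUpTo f (suc a) ++ l ≡ applyUpTo f a ++ f a ∷ l
  applyUpTo-suc-++ f zero l = refl
  applyUpTo-suc-++ f (suc a) l = cong (f 0 ∷_) (applyUpTo-suc-++ (λ i → f (suc i)) a l)

  applyUpTo-branch-injective : (f g : ℕ → V) → (∀ i j → g i ≢ f j) → ∀ a b {Y z Z} → (∀ j → z ≢ f j)
    → applyUpTo f a ++ f a ∷ g a ∷ Y ≡ applyUpTo f b ++ f b ∷ z ∷ Z → a ≡ b × g a ≡ z × Y ≡ Z
  applyUpTo-branch-injective f g g≢f zero zero z≢f refl = refl , refl , refl
  applyUpTo-branch-injective f g g≢f zero (suc zero) z≢f e = ⊥-elim (g≢f 0 1 (proj₁ (∷-injective (proj₂ (∷-injective e)))))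
  applyUpTo-branch-injective f g g≢f zero (suc (suc b)) z≢f e = ⊥-elim (g≢f 0 1 (proj₁ (∷-injective (proj₂ (∷-injective e)))))
  applyUpTo-branch-injective f g g≢f (suc zero) zero z≢f e = ⊥-elim (z≢f 1 (sym (proj₁ (∷-injective (proj₂ (∷-injective e))))))
  applyUpTo-branch-injective f g g≢f (suc (suc a)) zero z≢f e = ⊥-elim (z≢f 1 (sym (proj₁ (∷-injective (proj₂ (∷-injective e))))))
  applyUpTo-branch-injective f g g≢f (suc a) (suc b) z≢f e
    with applyUpTo-branch-injective (λ i → f (suc i)) (λ i → g (suc i)) (λ i j → g≢f (suc i) (suc j)) a b (λ j → z≢f (suc j)) (proj₂ (∷-injective e))
  ... | refl , e₂ , e₃ = refl , e₂ , e₃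

module Arithmetic where

  open import Data.Nat using (ℕ; zero; suc; _+_; _*_; _∸_; _<_; _≤_; z≤n; s≤s; ⌊_/2⌋)
  open import Data.Nat.Tactic.RingSolver using (solve-∀)
  open import Data.Nat.Properties
  open import Data.Bool using (Bool; true; false; not; _xor_)
  open import Data.Bool.Properties using (not-involutive; not-injective; not-distribˡ-xor; not-distribʳ-xor)
  open import Data.List using (List; applyUpTo; concat; length)
  open import Data.List.Properties using (length-++)
  open import Data.Product using (∃; _,_)
  open import Relation.Binary.PropositionalEquality

  parity : ℕ → Bool
  parity zero = false
  parity (suc n) = not (parity n)

  parity-double : ∀ b → parity (b + b) ≡ false
  parity-double zero = refl
  parity-double (suc b) = trans (cong (λ t → not (parity t)) (+-suc b b)) (trans (not-involutive (parity (b + b))) (parity-double b))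

  even⇒2≤ : ∀ a → 1 ≤ a → parity a ≡ false → 2 ≤ a
  even⇒2≤ (suc zero) _ ()
  even⇒2≤ (suc (suc a)) _ _ = s≤s (s≤s z≤n)

  even⇒2+double : ∀ a → parity a ≡ false → 2 ≤ a → ∃ λ b → a ≡ suc (suc (b + b))
  even⇒2+double (suc (suc zero)) e _ = 0 , refl
  even⇒2+double (suc (suc (suc zero))) () _
  even⇒2+double (suc (suc (suc (suc a)))) e _
    with even⇒2+double (suc (suc a)) (trans (sym (not-involutive (parity (suc (suc a))))) e) (s≤s (s≤s z≤n))
  ... | b , eq = suc b , cong (λ t → suc (suc t)) (trans eq (cong suc (sym (+-suc b b))))

  double-injective : ∀ b b' → b + b ≡ b' + b' → b ≡ b'
  double-injective b b' e = trans (n≡⌊n+n/2⌋ b) (trans (cong ⌊_/2⌋ e) (sym (n≡⌊n+n/2⌋ b')))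

  ⌊1+n+n/2⌋≡n : ∀ n → ⌊ suc (n + n) /2⌋ ≡ n
  ⌊1+n+n/2⌋≡n zero = refl
  ⌊1+n+n/2⌋≡n (suc n) = cong suc (trans (cong ⌊_/2⌋ (+-suc n n)) (⌊1+n+n/2⌋≡n n))

  2+b+b≤n⇒b<⌊n/2⌋ : ∀ b n → suc (suc (b + b)) ≤ n → b < ⌊ n /2⌋
  2+b+b≤n⇒b<⌊n/2⌋ zero (suc (suc n)) p = s≤s z≤n
  2+b+b≤n⇒b<⌊n/2⌋ b (suc zero) (s≤s ())
  2+b+b≤n⇒b<⌊n/2⌋ (suc b) (suc (suc n)) (s≤s (s≤s p)) = s≤s (2+b+b≤n⇒b<⌊n/2⌋ b n (subst (_≤ n) (cong suc (+-suc b b)) p))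

  b<⌊n/2⌋⇒2+b+b≤n : ∀ b n → b < ⌊ n /2⌋ → suc (suc (b + b)) ≤ n
  b<⌊n/2⌋⇒2+b+b≤n zero (suc (suc n)) p = s≤s (s≤s z≤n)
  b<⌊n/2⌋⇒2+b+b≤n (suc b) (suc (suc n)) (s≤s p) = s≤s (s≤s (subst (_≤ n) (sym (cong suc (+-suc b b))) (b<⌊n/2⌋⇒2+b+b≤n b n p)))

  xor-cancelˡ : ∀ x r → x xor (x xor r) ≡ r
  xor-cancelˡ true r = not-involutive r
  xor-cancelˡ false r = refl

  xor-injective : ∀ x a b → x xor a ≡ x xor b → a ≡ b
  xor-injective x a b e = trans (sym (xor-cancelˡ x a)) (trans (cong (x xor_) e) (xor-cancelˡ x b))

  not-xor : ∀ x y → not x xor y ≡ not (x xor y)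
  not-xor x y = sym (not-distribˡ-xor x y)

  xor-not : ∀ x y → x xor not y ≡ not (x xor y)
  xor-not x y = sym (not-distribʳ-xor x y)

  xor-across : ∀ p r r' → p xor r' ≡ not (p xor r) → r' ≡ not r
  xor-across p r r' e = xor-injective p r' (not r) (trans e (sym (xor-not p r)))

  xor-forward : ∀ p r r' → not p xor r' ≡ not (p xor r) → r' ≡ r
  xor-forward p r r' e = xor-injective p r' r (not-injective (trans (sym (not-xor p r')) e))

  xor-backward : ∀ p r r' → p xor r' ≡ not (not p xor r) → r' ≡ r
  xor-backward p r r' e = xor-injective p r' r (trans e (trans (cong not (not-xor p r)) (not-involutive (p xor r))))

  triangle : ℕ → ℕ
  triangle zero = 0
  triangle (suc n) = suc n + triangle n

  triangle-double : ∀ t → triangle t + triangle t ≡ t * suc t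
  triangle-double zero = refl
  triangle-double (suc t) = trans (shuffle (suc t) (triangle t)) (trans (cong (suc t + suc t +_) (triangle-double t)) (expand t))
    where
    shuffle : ∀ a b → a + b + (a + b) ≡ a + a + (b + b)
    shuffle = solve-∀
    expand : ∀ t → suc t + suc t + t * suc t ≡ suc t * suc (suc t)
    expand = solve-∀

  sumUpTo : (ℕ → ℕ) → ℕ → ℕ
  sumUpTo c zero = 0
  sumUpTo c (suc n) = c 0 + sumUpTo (λ i → c (suc i)) n

  sumUpTo-triangle : ∀ N → sumUpTo (λ i → N ∸ i) N ≡ triangle N
  sumUpTo-triangle zero = refl
  sumUpTo-triangle (suc N) = cong (suc N +_) (sumUpTo-triangle N)

  length-concat-applyUpTo : ∀ {V : Set} (g : ℕ → List (List V)) (c : ℕ → ℕ) n → (∀ i → length (g i) ≡ c i)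
    → length (concat (applyUpTo g n)) ≡ sumUpTo c n
  length-concat-applyUpTo g c zero eq = refl
  length-concat-applyUpTo g c (suc n) eq =
    trans (length-++ (g 0)) (cong₂ _+_ (eq 0) (length-concat-applyUpTo (λ i → g (suc i)) (λ i → c (suc i)) n (λ i → eq (suc i))))

module Strips where

  open import Data.Nat using (ℕ; zero; suc; _+_; _∸_; _<_; _≤_; z≤n; s≤s)
  open import Data.Nat.Properties
  open import Data.Bool using (Bool; not; _xor_)
  open import Data.Bool.Properties using (not-involutive)
  open import Data.List using (List; []; _∷_; _++_; [_]; length; applyUpTo; applyDownFrom)
  open import Data.List.Properties using (∷-injective; ++-assoc; ++-identityʳ; length-++; length-applyUpTo; length-applyDownFrom; applyDownFrom-∷ʳ)
  open import Data.List.Membership.Propositional using (_∈_)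
  open import Data.List.Membership.Propositional.Properties using (∈-++⁻; ∈-applyUpTo⁻; ∈-applyDownFrom⁻)
  import Data.List.Relation.Unary.Unique.Propositional.Properties as Unique
  import Data.List.Relation.Unary.Linked.Properties as Linked
  open import Data.List.Relation.Unary.Any using (here; there)
  open import Data.List.Relation.Unary.All as All using (All; []; _∷_)
  open import Data.List.Relation.Unary.AllPairs using ([]; _∷_)
  open import Data.List.Relation.Unary.Linked using (Linked; []; [-]; _∷_) renaming (tail to Linked-tail)
  open import Data.List.Relation.Unary.Unique.Propositional using (Unique)
  open import Data.Product using (_×_; _,_; proj₁; proj₂; ∃)
  open import Data.Sum using (_⊎_; inj₁; inj₂) renaming (swap to ⊎-swap)
  open import Data.Empty using (⊥; ⊥-elim)
  open import Relation.Binary.Definitions using (tri<; tri≈; tri>)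
  open import Relation.Binary.PropositionalEquality hiding ([_])
  open Basics
  open Arithmetic

  private variable
    V : Set

  data StripStep : ℕ → Bool → ℕ → Bool → Set where
    across : ∀ i r → StripStep i r i (not r)
    forward : ∀ i r → StripStep i r (suc i) r
    backward : ∀ i r → StripStep (suc i) r i r

  data StripStepView (i : ℕ) (r : Bool) (j : ℕ) (r' : Bool) : Set where
    across≡ : i ≡ j → r' ≡ not r → StripStepView i r j r'
    forward≡ : j ≡ suc i → r' ≡ r → StripStepView i r j r'
    backward≡ : i ≡ suc j → r' ≡ r → StripStepView i r j r'

  stripStep-view : ∀ {i r j r'} → StripStep i r j r' → StripStepView i r j r'
  stripStep-view (across i r) = across≡ refl refl
  stripStep-view (forward i r) = forward≡ refl refl
  stripStep-view (backward i r) = backward≡ refl refl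

  across′ : ∀ {i j r r'} → j ≡ i → r' ≡ not r → StripStep i r j r'
  across′ refl refl = across _ _

  forward′ : ∀ {i j r r'} → j ≡ suc i → r' ≡ r → StripStep i r j r'
  forward′ refl refl = forward _ _

  backward′ : ∀ {i j r r'} → i ≡ suc j → r' ≡ r → StripStep i r j r'
  backward′ refl refl = backward _ _

  stripStep-col : ∀ {i r j r'} → StripStep i r j r' → j ≤ suc i × i ≤ suc j
  stripStep-col (across i r) = n≤1+n i , n≤1+n i
  stripStep-col (forward i r) = ≤-refl , m≤n⇒m≤1+n (n≤1+n i)
  stripStep-col (backward i r) = m≤n⇒m≤1+n (n≤1+n i) , ≤-refl

  -- A strip of length L is given by an embedding emb i r (column i < L, side r) of the 2 × L grid.
  -- corridor emb L k r zigzags across the first k columns and then runs out along side r and back along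
  -- the other side; for k = L − 1 it is the full zigzag.
  corridor : (ℕ → Bool → V) → ℕ → ℕ → Bool → List V
  corridor emb L zero r = applyUpTo (λ i → emb i r) L ++ applyDownFrom (λ i → emb i (not r)) L
  corridor emb zero (suc k) r = []
  corridor emb (suc L) (suc k) r = emb 0 r ∷ emb 0 (not r) ∷ corridor (λ i → emb (suc i)) L k (not r)

  corridor-full-last : (emb : ℕ → Bool → V) (L : ℕ) (r : Bool)
    → ∃ λ ys → corridor emb (suc L) L r ≡ ys ++ [ emb L (parity L xor not r) ]
  corridor-full-last emb zero r = emb 0 r ∷ [] , refl
  corridor-full-last emb (suc L) r with corridor-full-last (λ i → emb (suc i)) L (not r)
  ... | ys , e = emb 0 r ∷ emb 0 (not r) ∷ ys , cong (λ t → emb 0 r ∷ emb 0 (not r) ∷ t) (trans e (cong (λ t → ys ++ [ emb (suc L) t ]) side))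
    where
    side : parity L xor not (not r) ≡ not (parity L) xor not r
    side = trans (cong (parity L xor_) (not-involutive r))
                 (sym (trans (not-xor (parity L) (not r)) (trans (cong not (xor-not (parity L) r)) (not-involutive _))))

  InStrip : ℕ → (ℕ → Bool → V) → V → Set
  InStrip L emb v = ∃ λ i → ∃ λ r → i < L × v ≡ emb i r

  StripInjective : ℕ → (ℕ → Bool → V) → Set
  StripInjective L emb = ∀ i j r r' → i < L → j < L → emb i r ≡ emb j r' → i ≡ j × r ≡ r'

  stripInjective-suc : ∀ {L} {emb : ℕ → Bool → V} → StripInjective (suc L) emb → StripInjective L (λ i → emb (suc i))
  stripInjective-suc inj i j r r' p q e with inj _ _ _ _ (s≤s p) (s≤s q) e
  ... | refl , refl = refl , refl

  corridor-head : (emb : ℕ → Bool → V) (L k : ℕ) (r : Bool) → ∃ λ t → corridor emb (suc L) k r ≡ emb 0 r ∷ t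
  corridor-head emb L zero r = _ , refl
  corridor-head emb L (suc k) r = _ , refl

  corridor-last : (emb : ℕ → Bool → V) (L k : ℕ) (r : Bool) → k < L
    → ∃ λ ys → ∃ λ r' → corridor emb L k r ≡ ys ++ [ emb k r' ]
  corridor-last emb (suc L) zero r _ =
    applyUpTo (λ i → emb i r) (suc L) ++ applyDownFrom (λ i → emb (suc i) (not r)) L , not r ,
    trans (cong (applyUpTo (λ i → emb i r) (suc L) ++_) (sym (applyDownFrom-∷ʳ (λ i → emb i (not r)) L)))
          (sym (++-assoc (applyUpTo (λ i → emb i r) (suc L)) _ _))
  corridor-last emb (suc L) (suc k) r (s≤s p) with corridor-last (λ i → emb (suc i)) L k (not r) p
  ... | ys , r' , e = emb 0 r ∷ emb 0 (not r) ∷ ys , r' , cong (λ t → emb 0 r ∷ emb 0 (not r) ∷ t) e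

  corridor-injective : (emb : ℕ → Bool → V) (L k k' : ℕ) (r : Bool) → StripInjective L emb → k < L → k' < L
    → corridor emb L k r ≡ corridor emb L k' r → k ≡ k'
  corridor-injective emb L zero zero r inj p q e = refl
  corridor-injective emb (suc zero) zero (suc k') r inj p (s≤s ()) e
  corridor-injective emb (suc (suc L)) zero (suc k') r inj p q e =
    ⊥-elim (1+n≢0 (proj₁ (inj _ _ _ _ (s≤s (s≤s z≤n)) (s≤s z≤n) (proj₁ (∷-injective (proj₂ (∷-injective e)))))))
  corridor-injective emb (suc zero) (suc k) zero r inj (s≤s ()) q e
  corridor-injective emb (suc (suc L)) (suc k) zero r inj p q e =
    ⊥-elim (1+n≢0 (proj₁ (inj _ _ _ _ (s≤s (s≤s z≤n)) (s≤s z≤n) (sym (proj₁ (∷-injective (proj₂ (∷-injective e))))))))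
  corridor-injective emb (suc L) (suc k) (suc k') r inj (s≤s p) (s≤s q) e =
    cong suc (corridor-injective (λ i → emb (suc i)) L k k' (not r) (stripInjective-suc inj) p q (proj₂ (∷-injective (proj₂ (∷-injective e)))))

  ∈-corridor⁻ : (emb : ℕ → Bool → V) (L k : ℕ) (r : Bool) (v : V) → v ∈ corridor emb L k r → InStrip L emb v
  ∈-corridor⁻ emb L zero r v m with ∈-++⁻ (applyUpTo (λ i → emb i r) L) m
  ... | inj₁ m′ with ∈-applyUpTo⁻ (λ i → emb i r) m′
  ...   | i , p , e = i , r , p , e
  ∈-corridor⁻ emb L zero r v m | inj₂ m′ with ∈-applyDownFrom⁻ (λ i → emb i (not r)) m′
  ...   | i , p , e = i , not r , p , e
  ∈-corridor⁻ emb (suc L) (suc k) r v (here e) = 0 , r , s≤s z≤n , e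
  ∈-corridor⁻ emb (suc L) (suc k) r v (there (here e)) = 0 , not r , s≤s z≤n , e
  ∈-corridor⁻ emb (suc L) (suc k) r v (there (there m)) with ∈-corridor⁻ (λ i → emb (suc i)) L k (not r) v m
  ... | i , r' , p , e = suc i , r' , s≤s p , e

  corridor-unique : (emb : ℕ → Bool → V) (L k : ℕ) (r : Bool) → StripInjective L emb → Unique (corridor emb L k r)
  corridor-unique emb L zero r inj = Unique.++⁺
    (Unique.applyUpTo⁺₁ _ L (λ i<j j<L e → <-irrefl (proj₁ (inj _ _ _ _ (<-trans i<j j<L) j<L e)) i<j))
    (Unique.applyDownFrom⁺₁ _ L (λ j<i i<L e → <-irrefl (sym (proj₁ (inj _ _ _ _ i<L (<-trans j<i i<L) e))) j<i))
    (disjoint-by (λ v m → ∈-applyUpTo⁻ (λ i → emb i r) m) (λ v m → ∈-applyDownFrom⁻ (λ i → emb i (not r)) m)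
       (λ v (i , p , e₁) (j , q , e₂) → not-≢ r (sym (proj₂ (inj _ _ _ _ p q (trans (sym e₁) e₂))))))
  corridor-unique emb zero (suc k) r inj = []
  corridor-unique emb (suc L) (suc k) r inj =
    All.tabulate (λ {v} → first≢ v) ∷ All.tabulate (λ {v} → second≢ v) ∷ corridor-unique (λ i → emb (suc i)) L k (not r) (stripInjective-suc inj)
    where
    later≢ : ∀ {r'} v → v ∈ corridor (λ i → emb (suc i)) L k (not r) → emb 0 r' ≢ v
    later≢ v m e with ∈-corridor⁻ (λ i → emb (suc i)) L k (not r) v m
    ... | i , _ , p , e' = 1+n≢0 (sym (proj₁ (inj _ _ _ _ (s≤s z≤n) (s≤s p) (trans e e'))))
    second≢ : ∀ v → v ∈ corridor (λ i → emb (suc i)) L k (not r) → emb 0 (not r) ≢ v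
    second≢ = later≢
    first≢ : ∀ v → v ∈ emb 0 (not r) ∷ corridor (λ i → emb (suc i)) L k (not r) → emb 0 r ≢ v
    first≢ v (here e) e' = not-≢ r (sym (proj₂ (inj _ _ _ _ (s≤s z≤n) (s≤s z≤n) (trans e' e))))
    first≢ v (there m) = later≢ v m

  length-corridor : (emb : ℕ → Bool → V) (L k : ℕ) (r : Bool) → length (corridor emb L k r) ≡ L + L
  length-corridor emb L zero r =
    trans (length-++ (applyUpTo (λ i → emb i r) L)) (cong₂ _+_ (length-applyUpTo _ L) (length-applyDownFrom _ L))
  length-corridor emb zero (suc k) r = refl
  length-corridor emb (suc L) (suc k) r =
    cong suc (trans (cong suc (length-corridor (λ i → emb (suc i)) L k (not r))) (sym (+-suc L L)))

  module Paths {V : Set} (A : V → V → Set) where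

    stays-in : (X Y : V → Set) → ∀ x l → Linked A (x ∷ l) → X x
      → (∀ v → v ∈ x ∷ l → X v ⊎ Y v)
      → (∀ u v → X u → Y v → A u v → v ∈ x ∷ l → ⊥)
      → ∀ v → v ∈ x ∷ l → X v
    stays-in X Y x l lk Xx cov cr v (here refl) = Xx
    stays-in X Y x (y ∷ l) (axy ∷ lk) Xx cov cr v (there m) with cov y (there (here refl))
    ... | inj₂ Yy = ⊥-elim (cr x y Xx Yy axy (there (here refl)))
    ... | inj₁ Xy = stays-in X Y y l lk Xy (λ w m′ → cov w (there m′)) (λ u w Xu Yw a m′ → cr u w Xu Yw a (there m′)) v m

    separated : (X Y : V → Set) → ∀ l → Linked A l → (∀ v → v ∈ l → X v ⊎ Y v) → (∀ v → X v → Y v → ⊥)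
      → (∀ u v → X u → Y v → A u v → ⊥) → (∀ u v → Y u → X v → A u v → ⊥)
      → ∀ {a b} → a ∈ l → X a → b ∈ l → Y b → ⊥
    separated X Y (x ∷ l) lk cl X∩Y X↛Y Y↛X a∈ Xa b∈ Yb with cl x (here refl)
    ... | inj₁ Xx = X∩Y _ (stays-in X Y x l lk Xx cl (λ u v Xu Yv e _ → X↛Y u v Xu Yv e) _ b∈) Yb
    ... | inj₂ Yx = X∩Y _ Xa (stays-in Y X x l lk Yx (λ v m → ⊎-swap (cl v m)) (λ u v Yu Xv e _ → Y↛X u v Yu Xv e) _ a∈)

    forced-path : ∀ M (e : ℕ → V) l → Linked A (e 0 ∷ l) → Unique (e 0 ∷ l)
      → (∀ v → v ∈ e 0 ∷ l → ∃ λ i → i < M × v ≡ e i)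
      → (∀ i → i < M → e i ∈ e 0 ∷ l)
      → (∀ i j → i < M → j < M → e i ≡ e j → i ≡ j)
      → (∀ i j → i < M → j < M → A (e i) (e j) → j ≡ suc i ⊎ i ≡ suc j)
      → e 0 ∷ l ≡ applyUpTo e M
    forced-path zero e l lk u mem cov inj adj with mem (e 0) (here refl)
    ... | i , () , _
    forced-path (suc zero) e [] lk u mem cov inj adj = refl
    forced-path (suc (suc M)) e [] lk u mem cov inj adj with cov 1 (s≤s (s≤s z≤n))
    ... | here eq with inj 1 0 (s≤s (s≤s z≤n)) (s≤s z≤n) eq
    ... | ()
    forced-path (suc zero) e (w ∷ l) (a ∷ lk) u mem cov inj adj with mem w (there (here refl))
    ... | zero , j<M , refl = ⊥-elim (unique-head≢ u (here refl) refl)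
    ... | suc j , s≤s () , refl
    forced-path (suc (suc M)) e (w ∷ l) (a ∷ lk) u mem cov inj adj with mem w (there (here refl))
    ... | j , j<M , refl with adj 0 j (s≤s z≤n) j<M a
    ... | inj₂ ()
    ... | inj₁ refl = cong (e 0 ∷_) (forced-path (suc M) (λ i → e (suc i)) l lk (unique-tail u) mem′ cov′ inj′ adj′)
      where
      mem′ : ∀ v → v ∈ e 1 ∷ l → ∃ λ i → i < suc M × v ≡ e (suc i)
      mem′ v m with mem v (there m)
      ... | zero , _ , refl = ⊥-elim (unique-head≢ u m refl)
      ... | suc i , s≤s i<M , refl = i , i<M , refl
      cov′ : ∀ i → i < suc M → e (suc i) ∈ e 1 ∷ l
      cov′ i i<M with cov (suc i) (s≤s i<M)
      ... | there m = m
      ... | here eq with inj (suc i) 0 (s≤s i<M) (s≤s z≤n) eq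
      ... | ()
      inj′ : ∀ i j → i < suc M → j < suc M → e (suc i) ≡ e (suc j) → i ≡ j
      inj′ i j p q eq = suc-injective (inj (suc i) (suc j) (s≤s p) (s≤s q) eq)
      adj′ : ∀ i j → i < suc M → j < suc M → A (e (suc i)) (e (suc j)) → j ≡ suc i ⊎ i ≡ suc j
      adj′ i j p q a with adj (suc i) (suc j) (s≤s p) (s≤s q) a
      ... | inj₁ eq = inj₁ (suc-injective eq)
      ... | inj₂ eq = inj₂ (suc-injective eq)

    first-crossing : (X Y : V → Set) (cx cy : V) → (∀ u v → A u v → A v u) → ∀ x l → Linked A (x ∷ l) → Unique (x ∷ l) → X x
      → (∀ v → v ∈ x ∷ l → X v ⊎ Y v)
      → (∀ u v → X u → Y v → A u v → u ≡ cx × v ≡ cy)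
      → ∃ λ q₁ → ∃ λ p₂ → x ∷ l ≡ (x ∷ q₁) ++ p₂ × All X (x ∷ q₁) × All Y p₂
         × (p₂ ≡ [] ⊎ ∃ λ p₁′ → ∃ λ p₂′ → x ∷ q₁ ≡ p₁′ ++ [ cx ] × p₂ ≡ cy ∷ p₂′)
    first-crossing X Y cx cy sym-A x [] lk u Xx cl ed = [] , [] , refl , Xx ∷ [] , [] , inj₁ refl
    first-crossing X Y cx cy sym-A x (y ∷ l) (a ∷ lk) u Xx cl ed with cl y (there (here refl))
    ... | inj₁ Xy with first-crossing X Y cx cy sym-A y l lk (unique-tail u) Xy (λ v m → cl v (there m)) ed
    ...   | q₁ , p₂ , eq , ax , ay , inj₁ e = y ∷ q₁ , p₂ , cong (x ∷_) eq , Xx ∷ ax , ay , inj₁ e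
    ...   | q₁ , p₂ , eq , ax , ay , inj₂ (p₁′ , p₂′ , e₁ , e₂) =
            y ∷ q₁ , p₂ , cong (x ∷_) eq , Xx ∷ ax , ay , inj₂ (x ∷ p₁′ , p₂′ , cong (x ∷_) e₁ , e₂)
    first-crossing X Y cx cy sym-A x (y ∷ l) (a ∷ lk) u Xx cl ed | inj₂ Yy with ed x y Xx Yy a
    ... | refl , refl =
      [] , y ∷ l , refl , Xx ∷ [] ,
      All.tabulate (λ {v} → stays-in Y X y l lk Yy (λ w m → ⊎-swap (cl w (there m))) no-return v) ,
      inj₂ ([] , l , refl , refl)
      where
      no-return : ∀ p q → Y p → X q → A p q → q ∈ y ∷ l → ⊥
      no-return p q Yp Xq apq m with ed q p Xq Yp (sym-A p q apq)
      ... | refl , _ = unique-head≢ u m refl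

    corridor-linked : ∀ (emb : ℕ → Bool → V) L k r x → (∀ L' → L ≡ suc L' → A x (emb 0 r))
      → (∀ i r → i < L → A (emb i r) (emb i (not r)))
      → (∀ i r → suc i < L → A (emb i r) (emb (suc i) r))
      → (∀ i r → suc i < L → A (emb (suc i) r) (emb i r))
      → Linked A (x ∷ corridor emb L k r)
    corridor-linked emb zero zero r x hx hR hF hB = [-]
    corridor-linked emb zero (suc k) r x hx hR hF hB = [-]
    corridor-linked emb (suc L) zero r x hx hR hF hB = hx L refl ∷ subst (Linked A) (sym (applyUpTo-suc-++ out L _))
      (linked-++-∷ (applyUpTo out L) (subst (Linked A) (trans (sym (++-identityʳ (applyUpTo out (suc L)))) (applyUpTo-suc-++ out L []))
                                      (Linked.applyUpTo⁺₁ out (suc L) (λ p → hF _ r p)))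
         (hR L r ≤-refl)
         (Linked.applyDownFrom⁺₁ (λ i → emb i (not r)) (suc L) (λ p → hB _ (not r) p)))
      where
      out = λ i → emb i r
    corridor-linked emb (suc L) (suc k) r x hx hR hF hB = hx L refl ∷ hR 0 r (s≤s z≤n) ∷
      corridor-linked (λ i → emb (suc i)) L k (not r) (emb 0 (not r))
        (λ L' e → hF 0 (not r) (subst (1 <_) (cong suc (sym e)) (s≤s (s≤s z≤n))))
        (λ i r p → hR (suc i) r (s≤s p)) (λ i r p → hF (suc i) r (s≤s p)) (λ i r p → hB (suc i) r (s≤s p))

    StripAdjacency : ℕ → (ℕ → Bool → V) → Set
    StripAdjacency L emb = ∀ i j r r' → i < L → j < L → A (emb i r) (emb j r') → StripStep i r j r'

    module CorridorTail (L : ℕ) (emb : ℕ → Bool → V) (r₀ : Bool) (inj : StripInjective L emb) (adj : StripAdjacency L emb) where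

      Unvisited : ℕ → V → Set
      Unvisited j v = (∃ λ i → j ≤ i × i < L × v ≡ emb i r₀) ⊎ (∃ λ i → i < L × v ≡ emb i (not r₀))

      turn-at-end : ∀ j l → j + 1 ≡ L → Linked A (emb j (not r₀) ∷ l) → Unique (emb j r₀ ∷ emb j (not r₀) ∷ l)
        → (∀ v → v ∈ emb j r₀ ∷ emb j (not r₀) ∷ l → Unvisited j v)
        → (∀ v → Unvisited j v → v ∈ emb j r₀ ∷ emb j (not r₀) ∷ l)
        → emb j (not r₀) ∷ l ≡ applyDownFrom (λ i → emb i (not r₀)) L
      turn-at-end j l j+1≡L lk u mem cov =
        trans (back-from (trans (cong (_∸ 1) (sym j+1≡L)) (m+n∸n≡m j 1))) (applyUpTo-∸≡applyDownFrom (λ i → emb i (not r₀)) L)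
        where
        j<L : j < L
        j<L = subst (j <_) (trans (+-comm 1 j) j+1≡L) ≤-refl
        e : ℕ → V
        e t = emb (L ∸ suc t) (not r₀)
        back-mem : ∀ v → v ∈ emb j (not r₀) ∷ l → ∃ λ t → t < L × v ≡ e t
        back-mem v m with mem v (there m)
        ... | inj₁ (i , j≤i , i<L , refl) =
          ⊥-elim (unique-head≢ u m (cong (λ x → emb x r₀) (≤-antisym j≤i (≤-pred (subst (i <_) (trans (sym j+1≡L) (+-comm j 1)) i<L)))))
        ... | inj₂ (i , i<L , refl) = L ∸ suc i , mirror< i<L , cong (λ x → emb x (not r₀)) (sym (mirror-involutive i<L))
        back-cov : ∀ t → t < L → e t ∈ emb j (not r₀) ∷ l
        back-cov t t<L with cov (e t) (inj₂ (L ∸ suc t , mirror< t<L , refl))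
        ... | here eq = ⊥-elim (not-≢ r₀ (proj₂ (inj _ j (not r₀) r₀ (mirror< t<L) j<L eq)))
        ... | there m = m
        back-inj : ∀ t t' → t < L → t' < L → e t ≡ e t' → t ≡ t'
        back-inj t t' p q eq = mirror-injective p q (proj₁ (inj _ _ _ _ (mirror< p) (mirror< q) eq))
        back-adj : ∀ t t' → t < L → t' < L → A (e t) (e t') → t' ≡ suc t ⊎ t ≡ suc t'
        back-adj t t' p q a with stripStep-view (adj _ _ _ _ (mirror< p) (mirror< q) a)
        ... | across≡ _ eq = ⊥-elim (not-≢ (not r₀) (sym eq))
        ... | forward≡ eq _ = inj₂ (mirror-suc p q eq)
        ... | backward≡ eq _ = inj₁ (mirror-suc q p eq)
        back-from : L ∸ 1 ≡ j → emb j (not r₀) ∷ l ≡ applyUpTo e L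
        back-from refl = forced-path L e l lk (unique-tail u) back-mem back-cov back-inj back-adj

      -- A rung before the last column cuts the unvisited vertices into the other side left of the rung
      -- and everything right of it, with no edge between the two parts.
      no-early-turn : ∀ j l → suc j < L → 1 ≤ j → Linked A (emb j (not r₀) ∷ l) → Unique (emb j r₀ ∷ emb j (not r₀) ∷ l)
        → (∀ v → v ∈ emb j r₀ ∷ emb j (not r₀) ∷ l → Unvisited j v)
        → (∀ v → Unvisited j v → v ∈ emb j r₀ ∷ emb j (not r₀) ∷ l)
        → ⊥
      no-early-turn j l sj<L 1≤j lk u mem cov =
        separated Left Right l (Linked-tail lk) classify left∩right left↛right right↛left left∈ (0 , 1≤j , refl) right∈ (suc j , r₀ , ≤-refl , sj<L , refl)
        where
        j<L = <-trans (n<1+n j) sj<L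
        0<L = ≤-trans (s≤s z≤n) j<L
        Left Right : V → Set
        Left v = ∃ λ i → i < j × v ≡ emb i (not r₀)
        Right v = ∃ λ i → ∃ λ r → j < i × i < L × v ≡ emb i r
        classify : ∀ v → v ∈ l → Left v ⊎ Right v
        classify v m with mem v (there (there m))
        ... | inj₁ (i , j≤i , i<L , refl) with m≤n⇒m<n∨m≡n j≤i
        ...   | inj₁ j<i = inj₂ (i , r₀ , j<i , i<L , refl)
        ...   | inj₂ refl = ⊥-elim (unique-head≢ u (there m) refl)
        classify v m | inj₂ (i , i<L , refl) with <-cmp i j
        ... | tri< i<j _ _ = inj₁ (i , i<j , refl)
        ... | tri≈ _ refl _ = ⊥-elim (unique-head≢ (unique-tail u) m refl)
        ... | tri> _ _ j<i = inj₂ (i , not r₀ , j<i , i<L , refl)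
        left↛right : ∀ x y → Left x → Right y → A x y → ⊥
        left↛right _ _ (i , i<j , refl) (i' , r , j<i' , i'<L , refl) a with stripStep-col (adj _ _ _ _ (<-trans i<j j<L) i'<L a)
        ... | p , _ = <⇒≱ j<i' (≤-pred (≤-trans (s≤s p) (s≤s i<j)))
        right↛left : ∀ x y → Right x → Left y → A x y → ⊥
        right↛left _ _ (i' , r , j<i' , i'<L , refl) (i , i<j , refl) a with stripStep-col (adj _ _ _ _ i'<L (<-trans i<j j<L) a)
        ... | _ , p = <⇒≱ j<i' (≤-pred (≤-trans (s≤s p) (s≤s i<j)))
        right∈ : emb (suc j) r₀ ∈ l
        right∈ with cov _ (inj₁ (suc j , n≤1+n j , sj<L , refl))
        ... | here eq = ⊥-elim (<-irrefl (sym (proj₁ (inj _ _ _ _ sj<L j<L eq))) (n<1+n j))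
        ... | there (here eq) = ⊥-elim (<-irrefl (sym (proj₁ (inj _ _ _ _ sj<L j<L eq))) (n<1+n j))
        ... | there (there m) = m
        left∈ : emb 0 (not r₀) ∈ l
        left∈ with cov _ (inj₂ (0 , 0<L , refl))
        ... | here eq = ⊥-elim (not-≢ r₀ (proj₂ (inj _ _ _ _ 0<L j<L eq)))
        ... | there (here eq) = ⊥-elim (<-irrefl (proj₁ (inj _ _ _ _ 0<L j<L eq)) 1≤j)
        ... | there (there m) = m
        left∩right : ∀ v → Left v → Right v → ⊥
        left∩right _ (i , i<j , refl) (i' , r , j<i' , i'<L , e) =
          <-asym i<j (subst (j <_) (sym (proj₁ (inj _ _ _ _ (<-trans i<j j<L) i'<L e))) j<i')

      column< : ∀ {j m} → j + suc m ≡ L → j < L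
      column< {j} eq = subst (j <_) eq (m<m+n j (s≤s z≤n))

      unvisited-step-mem : ∀ j l → Unique (emb j r₀ ∷ emb (suc j) r₀ ∷ l)
        → (∀ v → v ∈ emb j r₀ ∷ emb (suc j) r₀ ∷ l → Unvisited j v) → ∀ v → v ∈ emb (suc j) r₀ ∷ l → Unvisited (suc j) v
      unvisited-step-mem j l u mem v m with mem v (there m)
      ... | inj₂ x = inj₂ x
      ... | inj₁ (i , j≤i , i<L , refl) with m≤n⇒m<n∨m≡n j≤i
      ...   | inj₁ j<i = inj₁ (i , j<i , i<L , refl)
      ...   | inj₂ refl = ⊥-elim (unique-head≢ u m refl)

      unvisited-step-cov : ∀ j l → j < L
        → (∀ v → Unvisited j v → v ∈ emb j r₀ ∷ emb (suc j) r₀ ∷ l) → ∀ v → Unvisited (suc j) v → v ∈ emb (suc j) r₀ ∷ l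
      unvisited-step-cov j l j<L cov v (inj₁ (i , p , q , refl)) with cov _ (inj₁ (i , <⇒≤ p , q , refl))
      ... | there m = m
      ... | here e = ⊥-elim (<-irrefl (sym (proj₁ (inj i j r₀ r₀ q j<L e))) p)
      unvisited-step-cov j l j<L cov v (inj₂ (i , q , refl)) with cov _ (inj₂ (i , q , refl))
      ... | there m = m
      ... | here e = ⊥-elim (not-≢ r₀ (proj₂ (inj i j (not r₀) r₀ q j<L e)))

      corridor-tail : ∀ m j l → j + suc m ≡ L → 1 ≤ j → Linked A (emb j r₀ ∷ l) → Unique (emb j r₀ ∷ l)
        → (∀ v → v ∈ emb j r₀ ∷ l → Unvisited j v) → (∀ v → Unvisited j v → v ∈ emb j r₀ ∷ l)
        → emb j r₀ ∷ l ≡ applyUpTo (λ t → emb (j + t) r₀) (suc m) ++ applyDownFrom (λ i → emb i (not r₀)) L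
      corridor-tail m j [] eq 1≤j lk u mem cov =
        ⊥-elim (not-≢ r₀ (proj₂ (inj 0 j _ _ 0<L (column< eq) (singleton (cov _ (inj₂ (0 , 0<L , refl)))))))
        where
        0<L : 0 < L
        0<L = ≤-trans (s≤s z≤n) (column< eq)
        singleton : ∀ {x y : V} → x ∈ y ∷ [] → x ≡ y
        singleton (here e) = e
      corridor-tail m j (w ∷ l) eq 1≤j (a ∷ lk) u mem cov with mem w (there (here refl))
      ... | inj₁ (i , j≤i , i<L , refl) with stripStep-view (adj j i r₀ r₀ (column< eq) i<L a)
      ...   | across≡ _ e = ⊥-elim (not-≢ r₀ (sym e))
      ...   | backward≡ e _ = ⊥-elim (1+n≰n (subst (_≤ i) e j≤i))
      ...   | forward≡ refl _ = step m eq
        where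
        j<L : j < L
        j<L = column< eq
        step : ∀ m → j + suc m ≡ L
          → emb j r₀ ∷ emb (suc j) r₀ ∷ l ≡ applyUpTo (λ t → emb (j + t) r₀) (suc m) ++ applyDownFrom (λ i → emb i (not r₀)) L
        step zero eq′ = ⊥-elim (<-irrefl (trans (+-comm 1 j) eq′) i<L)
        step (suc m) eq′ = cong₂ _∷_ (cong (λ x → emb x r₀) (sym (+-identityʳ j)))
          (trans (corridor-tail m (suc j) l (trans (sym (+-suc j (suc m))) eq′) (s≤s z≤n) lk (unique-tail u)
                                  (unvisited-step-mem j l u mem) (unvisited-step-cov j l j<L cov))
                 (cong (_++ applyDownFrom (λ i → emb i (not r₀)) L) (applyUpTo-cong (suc m) (λ t → cong (λ x → emb x r₀) (sym (+-suc j t))))))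
      corridor-tail m j (w ∷ l) eq 1≤j (a ∷ lk) u mem cov | inj₂ (i , i<L , refl)
        with stripStep-view (adj j i r₀ (not r₀) (column< eq) i<L a)
      ... | forward≡ _ e = ⊥-elim (not-≢ r₀ e)
      ... | backward≡ _ e = ⊥-elim (not-≢ r₀ e)
      ... | across≡ refl _ = turn m eq
        where
        turn : ∀ m → j + suc m ≡ L
          → emb j r₀ ∷ emb j (not r₀) ∷ l ≡ applyUpTo (λ t → emb (j + t) r₀) (suc m) ++ applyDownFrom (λ i → emb i (not r₀)) L
        turn zero eq′ = cong₂ _∷_ (cong (λ x → emb x r₀) (sym (+-identityʳ j))) (turn-at-end j l eq′ lk u mem cov)
        turn (suc m) eq′ = ⊥-elim (no-early-turn j l (subst (suc j <_) (trans (sym (+-suc j (suc m))) eq′) (s≤s (m<m+n j (s≤s z≤n)))) 1≤j lk u mem cov)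

    stripAdjacency-suc : ∀ {L} {emb : ℕ → Bool → V} → StripAdjacency (suc L) emb → StripAdjacency L (λ i → emb (suc i))
    stripAdjacency-suc adj i j r r' p q a with stripStep-view (adj _ _ _ _ (s≤s p) (s≤s q) a)
    ... | across≡ refl refl = across i r
    ... | forward≡ refl refl = forward i r
    stripAdjacency-suc adj (suc i) j r r' p q a | backward≡ refl refl = backward j r

    corridor-straight : ∀ L (emb : ℕ → Bool → V) r₀ l → StripInjective (suc (suc L)) emb → StripAdjacency (suc (suc L)) emb
      → Linked A (emb 1 r₀ ∷ l) → Unique (emb 0 r₀ ∷ emb 1 r₀ ∷ l)
      → (∀ v → v ∈ emb 0 r₀ ∷ emb 1 r₀ ∷ l → InStrip (suc (suc L)) emb v)
      → (∀ i r → i < suc (suc L) → emb i r ∈ emb 0 r₀ ∷ emb 1 r₀ ∷ l)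
      → emb 0 r₀ ∷ emb 1 r₀ ∷ l ≡ corridor emb (suc (suc L)) 0 r₀
    corridor-straight L emb r₀ l inj adj lk u mem cov =
      cong (emb 0 r₀ ∷_) (corridor-tail L 1 l refl (s≤s z≤n) lk (unique-tail u) mem′ cov′)
      where
      open CorridorTail (suc (suc L)) emb r₀ inj adj
      mem′ : ∀ v → v ∈ emb 1 r₀ ∷ l → Unvisited 1 v
      mem′ v m with mem v (there m)
      ... | i , r , i<L , refl with ≡∨≡not r r₀
      ...   | inj₂ refl = inj₂ (i , i<L , refl)
      mem′ v m | zero , r , i<L , refl | inj₁ refl = ⊥-elim (unique-head≢ u m refl)
      mem′ v m | suc i , r , i<L , refl | inj₁ refl = inj₁ (suc i , s≤s z≤n , i<L , refl)
      cov′ : ∀ v → Unvisited 1 v → v ∈ emb 1 r₀ ∷ l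
      cov′ v (inj₁ (i , 1≤i , i<L , refl)) with cov i r₀ i<L
      ... | there m = m
      ... | here e = ⊥-elim (<-irrefl (sym (proj₁ (inj _ _ _ _ i<L (s≤s z≤n) e))) 1≤i)
      cov′ v (inj₂ (i , i<L , refl)) with cov i (not r₀) i<L
      ... | there m = m
      ... | here e = ⊥-elim (not-≢ r₀ (proj₂ (inj _ _ _ _ i<L (s≤s z≤n) e)))

    corridor-single-column : ∀ (emb : ℕ → Bool → V) r₀ l → Unique (emb 0 r₀ ∷ emb 0 (not r₀) ∷ l)
      → (∀ v → v ∈ emb 0 (not r₀) ∷ l → InStrip 1 emb v) → l ≡ []
    corridor-single-column emb r₀ [] _ _ = refl
    corridor-single-column emb r₀ (w ∷ l) u mem with mem w (there (here refl))
    ... | suc _ , _ , s≤s () , _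
    ... | zero , r , _ , refl with ≡∨≡not r r₀
    ...   | inj₁ refl = ⊥-elim (unique-head≢ u (there (here refl)) refl)
    ...   | inj₂ refl = ⊥-elim (unique-head≢ (unique-tail u) (here refl) refl)

    corridor-complete : ∀ L (emb : ℕ → Bool → V) r₀ l → StripInjective L emb → StripAdjacency L emb
      → Linked A (emb 0 r₀ ∷ l) → Unique (emb 0 r₀ ∷ l)
      → (∀ v → v ∈ emb 0 r₀ ∷ l → InStrip L emb v) → (∀ i r → i < L → emb i r ∈ emb 0 r₀ ∷ l)
      → ∃ λ k → k < L × emb 0 r₀ ∷ l ≡ corridor emb L k r₀
    corridor-complete zero emb r₀ l inj adj lk u mem cov with mem _ (here refl)
    ... | _ , _ , () , _
    corridor-complete (suc L) emb r₀ [] inj adj lk u mem cov with cov 0 (not r₀) (s≤s z≤n)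
    ... | here e = ⊥-elim (not-≢ r₀ (proj₂ (inj _ _ _ _ (s≤s z≤n) (s≤s z≤n) e)))
    corridor-complete (suc L) emb r₀ (z ∷ l) inj adj (a ∷ lk) u mem cov with mem z (there (here refl))
    ... | j , r' , j<L , refl with stripStep-view (adj 0 j r₀ r' (s≤s z≤n) j<L a)
    ...   | backward≡ () _
    corridor-complete (suc zero) emb r₀ (z ∷ l) inj adj (a ∷ lk) u mem cov | .1 , .r₀ , s≤s () , refl | forward≡ refl refl
    corridor-complete (suc (suc L)) emb r₀ (z ∷ l) inj adj (a ∷ lk) u mem cov | .1 , .r₀ , j<L , refl | forward≡ refl refl =
      0 , s≤s z≤n , corridor-straight L emb r₀ l inj adj lk u mem cov
    corridor-complete (suc zero) emb r₀ (z ∷ l) inj adj (a ∷ lk) u mem cov | .0 , .(not r₀) , j<L , refl | across≡ refl refl =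
      0 , s≤s z≤n , cong (λ t → emb 0 r₀ ∷ emb 0 (not r₀) ∷ t) (corridor-single-column emb r₀ l u (λ v m → mem v (there m)))
    corridor-complete (suc (suc L)) emb r₀ (z ∷ []) inj adj (a ∷ lk) u mem cov | .0 , .(not r₀) , j<L , refl | across≡ refl refl
      with cov 1 r₀ (s≤s (s≤s z≤n))
    ... | here e = ⊥-elim (1+n≢0 (proj₁ (inj _ _ _ _ (s≤s (s≤s z≤n)) (s≤s z≤n) e)))
    ... | there (here e) = ⊥-elim (1+n≢0 (proj₁ (inj _ _ _ _ (s≤s (s≤s z≤n)) (s≤s z≤n) e)))
    corridor-complete (suc (suc L)) emb r₀ (z ∷ w ∷ l) inj adj (a ∷ b ∷ lk) u mem cov | .0 , .(not r₀) , j<L , refl | across≡ refl refl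
      with mem w (there (there (here refl)))
    ... | j , r , j<L′ , refl with stripStep-view (adj 0 j (not r₀) r (s≤s z≤n) j<L′ b)
    ...   | backward≡ () _
    ...   | across≡ refl e = ⊥-elim (unique-head≢ u (there (here refl)) (cong (emb 0) (sym (trans e (not-involutive r₀)))))
    ...   | forward≡ refl refl
      with corridor-complete (suc L) (λ i → emb (suc i)) (not r₀) l (stripInjective-suc inj) (stripAdjacency-suc adj)
             lk (unique-tail (unique-tail u)) mem′ cov′
      where
      mem′ : ∀ v → v ∈ emb 1 (not r₀) ∷ l → InStrip (suc L) (λ i → emb (suc i)) v
      mem′ v m with mem v (there (there m))
      ... | suc i , r , s≤s i<L , refl = i , r , i<L , refl
      ... | zero , r , _ , refl with ≡∨≡not r r₀
      ...   | inj₁ refl = ⊥-elim (unique-head≢ u (there m) refl)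
      ...   | inj₂ refl = ⊥-elim (unique-head≢ (unique-tail u) m refl)
      cov′ : ∀ i r → i < suc L → emb (suc i) r ∈ emb 1 (not r₀) ∷ l
      cov′ i r p = ∈-drop₂ (cov (suc i) r (s≤s p)) (λ e → 1+n≢0 (proj₁ (inj _ _ _ _ (s≤s p) (s≤s z≤n) e)))
                                                     (λ e → 1+n≢0 (proj₁ (inj _ _ _ _ (s≤s p) (s≤s z≤n) e)))
    ... | k , k<L , eq = suc k , s≤s k<L , cong (λ t → emb 0 r₀ ∷ emb 0 (not r₀) ∷ t) eq

module Ladder (m : ℕ) where

  open import Data.Nat using (ℕ; zero; suc; _+_; _*_; _∸_; _<_; _≤_; z≤n; s≤s; ⌊_/2⌋)
  open import Data.Nat.Properties
  open import Data.Nat.Tactic.RingSolver using (solve-∀)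
  open import Data.Bool using (Bool; true; false; not; _xor_)
  open import Data.Bool.Properties using (not-involutive)
  open import Data.List using (List; []; _∷_; _++_; [_]; applyUpTo; applyDownFrom; map; concat; length)
  open import Data.List.Properties using (++-assoc; ∷ʳ-injective; ∷-injective; ++-cancelˡ; length-map; length-++; length-applyUpTo; length-applyDownFrom)
  open import Data.List.Membership.Propositional using (_∈_)
  open import Data.List.Membership.Propositional.Properties
    using (∈-++⁺ˡ; ∈-++⁺ʳ; ∈-++⁻; ∈-map⁻; ∈-map⁺; ∈-concat⁻′; ∈-concat⁺′; ∈-applyUpTo⁻; ∈-applyDownFrom⁻; ∈-applyUpTo⁺)
  open import Data.List.Relation.Binary.Disjoint.Propositional using (Disjoint)
  open import Data.List.Relation.Unary.Any using (here; there)
  open import Data.List.Relation.Unary.All as All using (All; []; _∷_)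
  import Data.List.Relation.Unary.All.Properties as Allₚ
  open import Data.List.Relation.Unary.AllPairs using ([]; _∷_)
  import Data.List.Relation.Unary.AllPairs.Properties as AllPairsₚ
  open import Data.List.Relation.Unary.Linked using (Linked; []; [-]; _∷_)
  import Data.List.Relation.Unary.Linked.Properties as Linked
  open import Data.List.Relation.Unary.Unique.Propositional using (Unique)
  import Data.List.Relation.Unary.Unique.Propositional.Properties as Unique
  open import Data.Product using (_×_; _,_; proj₁; proj₂; ∃)
  open import Data.Sum using (_⊎_; inj₁; inj₂) renaming (swap to ⊎-swap)
  open import Data.Empty using (⊥; ⊥-elim)
  open import Relation.Nullary using (¬_)
  open import Relation.Binary.Definitions using (tri<; tri≈; tri>)
  open import Relation.Binary.PropositionalEquality hiding ([_])
  open Basics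
  open Arithmetic
  open Strips

  -- The graph for n = 2h symbols with h = m + 3: column c < h holds the nodes (c , false) and (c , true),
  -- standing for the symbols c + 1 and h + c + 1 (Circulant.label).  Symbols at distance h are joined by
  -- a rung, symbols at distance h ± 1 by a step to the neighbouring column on the other side, or, between
  -- the last and the first column, by a wrap on the same side.
  top : ℕ
  top = suc (suc m)

  h : ℕ
  h = suc top

  Node : Set
  Node = ℕ × Bool

  data Adj : Node → Node → Set where
    rung : ∀ c s → Adj (c , s) (c , not s)
    right : ∀ c s → suc c < h → Adj (c , s) (suc c , not s)
    left : ∀ c s → suc c < h → Adj (suc c , s) (c , not s)
    wrapR : ∀ s → Adj (top , s) (0 , s)
    wrapL : ∀ s → Adj (0 , s) (top , s)

  data AdjView (c : ℕ) (s : Bool) (v : Node) : Set where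
    rung≡ : v ≡ (c , not s) → AdjView c s v
    right≡ : suc c < h → v ≡ (suc c , not s) → AdjView c s v
    left≡ : ∀ c' → c ≡ suc c' → v ≡ (c' , not s) → AdjView c s v
    wrapR≡ : c ≡ top → v ≡ (0 , s) → AdjView c s v
    wrapL≡ : c ≡ 0 → v ≡ (top , s) → AdjView c s v

  adj-view : ∀ {c s v} → Adj (c , s) v → AdjView c s v
  adj-view (rung c s) = rung≡ refl
  adj-view (right c s p) = right≡ p refl
  adj-view (left c s p) = left≡ c refl refl
  adj-view (wrapR s) = wrapR≡ refl refl
  adj-view (wrapL s) = wrapL≡ refl refl

  Adj-sym : ∀ u v → Adj u v → Adj v u
  Adj-sym _ _ (rung c s) = subst (λ t → Adj (c , not s) (c , t)) (not-involutive s) (rung c (not s))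
  Adj-sym _ _ (right c s p) = subst (λ t → Adj (suc c , not s) (c , t)) (not-involutive s) (left c (not s) p)
  Adj-sym _ _ (left c s p) = subst (λ t → Adj (c , not s) (suc c , t)) (not-involutive s) (right c (not s) p)
  Adj-sym _ _ (wrapR s) = wrapL s
  Adj-sym _ _ (wrapL s) = wrapR s

  Valid : Node → Set
  Valid v = proj₁ v < h

  open Paths Adj

  rail coRail : ℕ → Node
  rail i = (i , parity i)
  coRail i = (i , not (parity i))

  rail≢coRail : ∀ i j → rail i ≢ coRail j
  rail≢coRail i j e with cong proj₁ e
  ... | refl = not-≢ (parity i) (sym (cong proj₂ e))

  coRail≢rail : ∀ i j → coRail i ≢ rail j
  coRail≢rail i j e = rail≢coRail j i (sym e)

  rail-linked : ∀ n → n ≤ h → Linked Adj (applyUpTo rail n)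
  rail-linked n p = Linked.applyUpTo⁺₁ rail n (λ {i} q → right i (parity i) (≤-trans q p))

  coRail-linked : ∀ n → n ≤ h → Linked Adj (applyUpTo coRail n)
  coRail-linked n p = Linked.applyUpTo⁺₁ coRail n (λ {i} q → right i (not (parity i)) (≤-trans q p))

  coRail-down-linked : ∀ n → n ≤ h → Linked Adj (applyDownFrom coRail n)
  coRail-down-linked n p = Linked.applyDownFrom⁺₁ coRail n
    (λ {i} q → subst (λ t → Adj (coRail (suc i)) (i , t)) (not-involutive (not (parity i))) (left i (not (parity (suc i))) (≤-trans q p)))

  rail-unique : ∀ n → Unique (applyUpTo rail n)
  rail-unique n = Unique.applyUpTo⁺₁ rail n (λ i<j _ e → <-irrefl (cong proj₁ e) i<j)

  coRail-unique : ∀ n → Unique (applyUpTo coRail n)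
  coRail-unique n = Unique.applyUpTo⁺₁ coRail n (λ i<j _ e → <-irrefl (cong proj₁ e) i<j)

  coRail-down-unique : ∀ n → Unique (applyDownFrom coRail n)
  coRail-down-unique n = Unique.applyDownFrom⁺₁ coRail n (λ j<i _ e → <-irrefl (sym (cong proj₁ e)) j<i)

  CoRailAdj : ℕ → ℕ → Set
  CoRailAdj i j = (j ≡ suc i ⊎ i ≡ suc j) ⊎ (i ≡ top × j ≡ 0 × parity top ≡ false) ⊎ (i ≡ 0 × j ≡ top × parity top ≡ false)

  coRail-adj : ∀ i j → Adj (coRail i) (coRail j) → CoRailAdj i j
  coRail-adj i j a with adj-view a
  ... | rung≡ e with cong proj₁ e
  ...   | refl = ⊥-elim (not-≢ (not (parity i)) (sym (cong proj₂ e)))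
  coRail-adj i j a | right≡ _ e = inj₁ (inj₁ (cong proj₁ e))
  coRail-adj i j a | left≡ c' e₁ e₂ = inj₁ (inj₂ (trans e₁ (cong suc (sym (cong proj₁ e₂)))))
  coRail-adj i j a | wrapR≡ refl e₂ with cong proj₁ e₂
  ... | refl = inj₂ (inj₁ (refl , refl , trans (sym (not-involutive (parity top))) (cong not (sym (cong proj₂ e₂)))))
  coRail-adj i j a | wrapL≡ refl e₂ with cong proj₁ e₂
  ... | refl = inj₂ (inj₂ (refl , refl , trans (sym (not-involutive (parity top))) (cong not (cong proj₂ e₂))))

  coRail-adj-below : ∀ {a i j} → a ≤ top → i < a → j < a → Adj (coRail i) (coRail j) → j ≡ suc i ⊎ i ≡ suc j
  coRail-adj-below a≤top i<a j<a e with coRail-adj _ _ e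
  ... | inj₁ step = step
  ... | inj₂ (inj₁ (refl , _)) = ⊥-elim (<⇒≱ i<a a≤top)
  ... | inj₂ (inj₂ (_ , refl , _)) = ⊥-elim (<⇒≱ j<a a≤top)

  coRail-adj-mirrored : ∀ {a i j} → a ≤ top → i < a → j < a → Adj (coRail (a ∸ suc i)) (coRail (a ∸ suc j)) → j ≡ suc i ⊎ i ≡ suc j
  coRail-adj-mirrored a≤top i<a j<a e with coRail-adj-below a≤top (mirror< i<a) (mirror< j<a) e
  ... | inj₁ e′ = inj₂ (mirror-suc i<a j<a e′)
  ... | inj₂ e′ = inj₁ (mirror-suc j<a i<a e′)

  -- Two embeddings of strips into the ladder: rightStrip l starts at column l and moves right,
  -- leftStrip starts at the last column and moves left; xor with the parity untwists the sides.
  rightStrip : ℕ → ℕ → Bool → Node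
  rightStrip l i r = (i + l , parity i xor r)

  leftStrip : ℕ → Bool → Node
  leftStrip i r = (h ∸ suc i , parity i xor r)

  rightStrip-injective : ∀ l D → StripInjective D (rightStrip l)
  rightStrip-injective l D i j r r' p q e with +-cancelʳ-≡ l i j (cong proj₁ e)
  ... | refl = refl , xor-injective (parity i) r r' (cong proj₂ e)

  leftStrip-injective : ∀ D → D ≤ top → StripInjective D leftStrip
  leftStrip-injective D D≤ i j r r' p q e with mirror-injective (m<n⇒m<1+n (≤-trans p D≤)) (m<n⇒m<1+n (≤-trans q D≤)) (cong proj₁ e)
  ... | refl = refl , xor-injective (parity i) r r' (cong proj₂ e)

  rightStrip-step : ∀ l i j r r' → 1 ≤ l → Adj (rightStrip l i r) (rightStrip l j r') → StripStep i r j r'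
  rightStrip-step l i j r r' 1≤l a with adj-view a
  ... | rung≡ e with +-cancelʳ-≡ l j i (cong proj₁ e)
  ...   | refl = across′ refl (xor-across (parity i) r r' (cong proj₂ e))
  rightStrip-step l i j r r' 1≤l a | right≡ _ e with +-cancelʳ-≡ l j (suc i) (cong proj₁ e)
  ... | refl = forward′ refl (xor-forward (parity i) r r' (cong proj₂ e))
  rightStrip-step l i j r r' 1≤l a | left≡ _ e₁ e₂ with +-cancelʳ-≡ l i (suc j) (trans e₁ (cong suc (sym (cong proj₁ e₂))))
  ... | refl = backward′ refl (xor-backward (parity j) r r' (cong proj₂ e₂))
  rightStrip-step l i j r r' 1≤l a | wrapR≡ e₁ e₂ = ⊥-elim (<-irrefl (sym (cong proj₁ e₂)) (≤-trans 1≤l (m≤n+m l j)))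
  rightStrip-step l i j r r' 1≤l a | wrapL≡ e₁ e₂ = ⊥-elim (<-irrefl (sym e₁) (≤-trans 1≤l (m≤n+m l i)))

  leftStrip-step : ∀ i j r r' → i < top → j < top → Adj (leftStrip i r) (leftStrip j r') → StripStep i r j r'
  leftStrip-step i j r r' p q a with adj-view a
  ... | rung≡ e with mirror-injective (m<n⇒m<1+n q) (m<n⇒m<1+n p) (cong proj₁ e)
  ...   | refl = across′ refl (xor-across (parity i) r r' (cong proj₂ e))
  leftStrip-step i j r r' p q a | right≡ _ e with mirror-suc (m<n⇒m<1+n p) (m<n⇒m<1+n q) (cong proj₁ e)
  ... | refl = backward′ refl (xor-backward (parity j) r r' (cong proj₂ e))
  leftStrip-step i j r r' p q a | left≡ _ e₁ e₂ with mirror-suc (m<n⇒m<1+n q) (m<n⇒m<1+n p) (trans e₁ (cong suc (sym (cong proj₁ e₂))))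
  ... | refl = forward′ refl (xor-forward (parity i) r r' (cong proj₂ e₂))
  leftStrip-step i j r r' p q a | wrapR≡ e₁ e₂ = ⊥-elim (<-irrefl (sym (cong proj₁ e₂)) (m<n⇒0<n∸m q))
  leftStrip-step i j r r' p q a | wrapL≡ e₁ e₂ = ⊥-elim (<-irrefl (sym e₁) (m<n⇒0<n∸m p))

  rightStrip-across : ∀ l i r → Adj (rightStrip l i r) (rightStrip l i (not r))
  rightStrip-across l i r = subst (λ t → Adj (i + l , parity i xor r) (i + l , t)) (sym (xor-not (parity i) r)) (rung (i + l) (parity i xor r))

  rightStrip-forward : ∀ l i r → suc i + l < h → Adj (rightStrip l i r) (rightStrip l (suc i) r)
  rightStrip-forward l i r p =
    subst (λ t → Adj (i + l , parity i xor r) (suc (i + l) , t)) (sym (not-xor (parity i) r)) (right (i + l) (parity i xor r) p)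

  rightStrip-backward : ∀ l i r → suc i + l < h → Adj (rightStrip l (suc i) r) (rightStrip l i r)
  rightStrip-backward l i r p = subst (λ t → Adj (suc (i + l) , not (parity i) xor r) (i + l , t))
    (trans (cong not (not-xor (parity i) r)) (not-involutive _)) (left (i + l) (not (parity i) xor r) p)

  ∸-suc : ∀ {a b} → b < a → a ∸ b ≡ suc (a ∸ suc b)
  ∸-suc {suc a} {b} (s≤s p) = +-∸-assoc 1 p

  leftStrip-across : ∀ i r → Adj (leftStrip i r) (leftStrip i (not r))
  leftStrip-across i r =
    subst (λ t → Adj (h ∸ suc i , parity i xor r) (h ∸ suc i , t)) (sym (xor-not (parity i) r)) (rung (h ∸ suc i) (parity i xor r))

  leftStrip-forward : ∀ i r → suc i < h → Adj (leftStrip i r) (leftStrip (suc i) r)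
  leftStrip-forward i r p = subst₂ (λ t t' → Adj (t , parity i xor r) (h ∸ suc (suc i) , t')) (sym (∸-suc p)) (sym (not-xor (parity i) r))
    (left (h ∸ suc (suc i)) (parity i xor r) (subst (_< h) (∸-suc p) (mirror< (m<n⇒m<1+n (≤-pred p)))))

  leftStrip-backward : ∀ i r → suc i < h → Adj (leftStrip (suc i) r) (leftStrip i r)
  leftStrip-backward i r p = subst₂ (λ t t' → Adj (h ∸ suc (suc i) , not (parity i) xor r) (t , t')) (sym (∸-suc p))
    (trans (cong not (not-xor (parity i) r)) (not-involutive _))
    (right (h ∸ suc (suc i)) (not (parity i) xor r) (subst (_< h) (∸-suc p) (mirror< (m<n⇒m<1+n (≤-pred p)))))


  rungPath : ℕ → List Node
  rungPath k = (0 , false) ∷ (0 , true) ∷ corridor (rightStrip 1) top k false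

  returnPath : ℕ → ℕ → List Node
  returnPath a k = applyUpTo rail a ++ rail a ∷ applyDownFrom coRail (suc a) ++ corridor leftStrip (top ∸ a) k true

  hairpinPath : List Node
  hairpinPath = applyUpTo rail top ++ rail top ∷ applyDownFrom coRail (suc top)

  zigzagPath : ℕ → List Node
  zigzagPath a = applyUpTo rail a ++ rail a ∷ coRail a ∷ corridor (rightStrip (suc a)) (top ∸ a) (top ∸ a ∸ 1) (parity a) ++ applyUpTo coRail a

  spiralPath : List Node
  spiralPath = applyUpTo rail top ++ rail top ∷ applyUpTo coRail h

  data Standard : List Node → Set where
    rung-path : ∀ k → k < top → Standard (rungPath k)
    return-path : ∀ a k → 1 ≤ a → k < top ∸ a → Standard (returnPath a k)
    hairpin-path : Standard hairpinPath
    zigzag-path : ∀ a → 2 ≤ a → a ≤ top → parity a ≡ false → Standard (zigzagPath a)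
    spiral-path : parity h ≡ false → Standard spiralPath

  GoodPath : List Node → Set
  GoodPath p = Linked Adj p × Unique p × (∀ v → v ∈ p → Valid v) × length p ≡ h + h

  rail-length : ∀ a {xs} ys → length xs ≡ ys → length (applyUpTo rail a ++ rail a ∷ xs) ≡ suc (a + ys)
  rail-length a {xs} ys eq = trans (cong length (sym (applyUpTo-suc-++ rail a xs)))
    (trans (length-++ (applyUpTo rail (suc a))) (cong₂ _+_ (length-applyUpTo rail (suc a)) eq))

  rungPath-good : ∀ k → k < top → GoodPath (rungPath k)
  rungPath-good k k<top = linked , unique , valid , length≡
    where
    column< : ∀ {i} → i < top → i + 1 < h
    column< {i} q = subst (_< h) (+-comm 1 i) (s≤s q)
    linked : Linked Adj (rungPath k)
    linked = rung 0 false ∷ corridor-linked (rightStrip 1) top k false (0 , true) (λ _ _ → right 0 true (s≤s (s≤s z≤n)))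
      (λ i r q → rightStrip-across 1 i r) (λ i r q → rightStrip-forward 1 i r (column< q)) (λ i r q → rightStrip-backward 1 i r (column< q))
    column0∉ : ∀ {s} v → v ∈ corridor (rightStrip 1) top k false → (0 , s) ≢ v
    column0∉ v m e with ∈-corridor⁻ (rightStrip 1) top k false v m
    ... | i , _ , _ , e' = 1+n≢0 (trans (+-comm 1 i) (sym (cong proj₁ (trans e e'))))
    unique : Unique (rungPath k)
    unique = All.tabulate (λ { {v} (here refl) () ; {v} (there m) → column0∉ v m })
           ∷ All.tabulate (λ {v} → column0∉ v) ∷ corridor-unique (rightStrip 1) top k false (rightStrip-injective 1 top)
    valid : ∀ v → v ∈ rungPath k → Valid v
    valid v (here refl) = s≤s z≤n
    valid v (there (here refl)) = s≤s z≤n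
    valid v (there (there m)) with ∈-corridor⁻ (rightStrip 1) top k false v m
    ... | i , r , q , refl = column< q
    length≡ : length (rungPath k) ≡ h + h
    length≡ = cong suc (trans (cong suc (length-corridor (rightStrip 1) top k false)) (sym (+-suc top top)))

  hairpinPath-good : GoodPath hairpinPath
  hairpinPath-good = linked-applyUpTo-++ rail top _ (rail-linked h ≤-refl) (rung top (parity top) ∷ coRail-down-linked h ≤-refl)
    , subst Unique (applyUpTo-suc-++ rail top _)
        (unique-++ (rail-unique h) (coRail-down-unique h) (λ v m → ∈-applyUpTo⁻ rail m) (λ v m → ∈-applyDownFrom⁻ coRail m)
          (λ v (i , _ , e₁) (j , _ , e₂) → rail≢coRail i j (trans (sym e₁) e₂)))
    , valid
    , rail-length top h (length-applyDownFrom coRail h)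
    where
    valid : ∀ v → v ∈ hairpinPath → Valid v
    valid v m with ∈-++-by (applyUpTo rail h) (λ v m → ∈-applyUpTo⁻ rail m) (λ v m → ∈-applyDownFrom⁻ coRail m) v
                     (subst (v ∈_) (sym (applyUpTo-suc-++ rail top _)) m)
    ... | inj₁ (i , p , refl) = p
    ... | inj₂ (i , p , refl) = p

  spiralPath-good : parity h ≡ false → GoodPath spiralPath
  spiralPath-good e = linked-applyUpTo-++ rail top _ (rail-linked h ≤-refl)
      (subst (λ t → Adj (top , t) (0 , true)) (sym parity-top) (wrapR true) ∷ coRail-linked h ≤-refl)
    , subst Unique (applyUpTo-suc-++ rail top _)
        (unique-++ (rail-unique h) (coRail-unique h) (λ v m → ∈-applyUpTo⁻ rail m) (λ v m → ∈-applyUpTo⁻ coRail m)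
          (λ v (i , _ , e₁) (j , _ , e₂) → rail≢coRail i j (trans (sym e₁) e₂)))
    , valid
    , rail-length top h (length-applyUpTo coRail h)
    where
    parity-top : parity top ≡ true
    parity-top = trans (sym (not-involutive (parity top))) (cong not e)
    valid : ∀ v → v ∈ spiralPath → Valid v
    valid v m with ∈-++-by (applyUpTo rail h) (λ v m → ∈-applyUpTo⁻ rail m) (λ v m → ∈-applyUpTo⁻ coRail m) v
                     (subst (v ∈_) (sym (applyUpTo-suc-++ rail top _)) m)
    ... | inj₁ (i , p , refl) = p
    ... | inj₂ (i , p , refl) = p

  module ReturnPathGood (a k : ℕ) (k<D : k < top ∸ a) where

    D : ℕ
    D = top ∸ a

    a<top : a < top
    a<top = m∸n≢0⇒n<m (λ e → n≮0 (subst (k <_) e k<D))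

    D≤top : D ≤ top
    D≤top = m∸n≤m top a

    a+D≡top : a + D ≡ top
    a+D≡top = m+[n∸m]≡n (<⇒≤ a<top)

    a<left : ∀ {j} → j < D → a < h ∸ suc j
    a<left {j} q = subst (_< top ∸ j) (trans (cong (_∸ D) (sym a+D≡top)) (m+n∸n≡m a D)) (∸-monoʳ-< q D≤top)

    a<h : suc a ≤ h
    a<h = m<n⇒m<1+n a<top

    linked : Linked Adj (returnPath a k)
    linked = linked-applyUpTo-++ rail a _ (rail-linked (suc a) a<h)
      (rung a (parity a) ∷ linked-applyDownFrom-++ coRail a _ (coRail-down-linked (suc a) a<h)
         (corridor-linked leftStrip D k true (0 , true) (λ _ _ → wrapL true) (λ i r q → leftStrip-across i r)
            (λ i r q → leftStrip-forward i r (bound q)) (λ i r q → leftStrip-backward i r (bound q))))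
      where
      bound : ∀ {i} → suc i < D → suc i < h
      bound q = m<n⇒m<1+n (≤-trans q D≤top)

    onRail : ∀ v → v ∈ applyUpTo rail (suc a) → ∃ λ i → i < suc a × v ≡ rail i
    onRail v m = ∈-applyUpTo⁻ rail m

    onCoRail : ∀ v → v ∈ applyDownFrom coRail (suc a) → ∃ λ i → i < suc a × v ≡ coRail i
    onCoRail v m = ∈-applyDownFrom⁻ coRail m

    onStrip : ∀ v → v ∈ corridor leftStrip D k true → InStrip D leftStrip v
    onStrip v m = ∈-corridor⁻ leftStrip D k true v m

    ≢strip : ∀ {i j r s} → i < suc a → j < D → (i , s) ≢ leftStrip j r
    ≢strip {i} p q e = <⇒≱ (a<left q) (subst (_≤ a) (cong proj₁ e) (≤-pred p))

    unique : Unique (returnPath a k)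
    unique = subst Unique (applyUpTo-suc-++ rail a _)
      (unique-++ (rail-unique (suc a))
         (unique-++ (coRail-down-unique (suc a)) (corridor-unique leftStrip D k true (leftStrip-injective D D≤top)) onCoRail onStrip
            (λ v (i , p , e₁) (j , r , q , e₂) → ≢strip p q (trans (sym e₁) e₂)))
         onRail (∈-++-by (applyDownFrom coRail (suc a)) onCoRail onStrip)
         (λ { v (i , p , e₁) (inj₁ (j , q , e₂)) → rail≢coRail i j (trans (sym e₁) e₂)
            ; v (i , p , e₁) (inj₂ (j , r , q , e₂)) → ≢strip p q (trans (sym e₁) e₂) }))

    valid : ∀ v → v ∈ returnPath a k → Valid v
    valid v m with ∈-++-by (applyUpTo rail (suc a)) onRail (∈-++-by (applyDownFrom coRail (suc a)) onCoRail onStrip) v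
                     (subst (v ∈_) (sym (applyUpTo-suc-++ rail a _)) m)
    ... | inj₁ (i , p , refl) = ≤-trans p a<h
    ... | inj₂ (inj₁ (i , p , refl)) = ≤-trans p a<h
    ... | inj₂ (inj₂ (j , r , q , refl)) = mirror< (m<n⇒m<1+n (≤-trans q D≤top))

    length≡ : length (returnPath a k) ≡ h + h
    length≡ = trans (rail-length a _ (trans (length-++ (applyDownFrom coRail (suc a)))
                                       (cong₂ _+_ (length-applyDownFrom coRail (suc a)) (length-corridor leftStrip D k true))))
      (trans (rearrange a D) (cong (λ t → suc t + suc t) a+D≡top))
      where
      rearrange : ∀ a d → suc (a + (suc a + (d + d))) ≡ suc (a + d) + suc (a + d)
      rearrange = solve-∀

  returnPath-good : ∀ a k → k < top ∸ a → GoodPath (returnPath a k)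
  returnPath-good a k k<D = linked , unique , valid , length≡
    where open ReturnPathGood a k k<D

  -- After the rung at column a the full zigzag ends at (top , true), which wraps to coRail 0 = (0 , true)
  -- exactly when a is even.
  zigzagPath-tail-linked : ∀ a D → 1 ≤ a → parity a ≡ false → a + D ≡ top
    → Linked Adj (coRail a ∷ corridor (rightStrip (suc a)) D (D ∸ 1) (parity a) ++ applyUpTo coRail a)
  zigzagPath-tail-linked (suc a') zero _ pa eq with suc-injective (trans (sym (+-identityʳ (suc a'))) eq)
  ... | refl = subst (λ t → Adj (top , not t) (0 , true)) (sym pa) (wrapR true) ∷ coRail-linked top (n≤1+n top)
  zigzagPath-tail-linked a@(suc a') (suc D') _ pa eq =
    subst (Linked Adj) (sym split) (linked-++-∷ (coRail a ∷ ys) (subst (Linked Adj) (cong (coRail a ∷_) ys-last) zigzag) last↝coRail₀ (coRail-linked a (<⇒≤ a<h)))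
    where
    strip : ℕ → Bool → Node
    strip = rightStrip (suc a)
    ys : List Node
    ys = proj₁ (corridor-full-last strip D' (parity a))
    ys-last : corridor strip (suc D') D' (parity a) ≡ ys ++ [ strip D' (parity D' xor not (parity a)) ]
    ys-last = proj₂ (corridor-full-last strip D' (parity a))
    column≡top : D' + suc a ≡ top
    column≡top = trans (+-suc D' a) (trans (cong suc (+-comm D' a)) (trans (sym (+-suc a D')) eq))
    a<h : a < h
    a<h = m<n⇒m<1+n (subst (a <_) eq (m<m+n a (s≤s z≤n)))
    column< : ∀ {i} → i < suc D' → i + suc a < h
    column< {i} q = s≤s (subst (i + suc a ≤_) column≡top (+-monoˡ-≤ (suc a) (≤-pred q)))
    last↝coRail₀ : Adj (strip D' (parity D' xor not (parity a))) (0 , true)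
    last↝coRail₀ = subst (λ v → Adj v (0 , true))
      (sym (cong₂ _,_ column≡top (trans (xor-cancelˡ (parity D') (not (parity a))) (cong not pa)))) (wrapR true)
    zigzag : Linked Adj (coRail a ∷ corridor strip (suc D') D' (parity a))
    zigzag = corridor-linked strip (suc D') D' (parity a) (coRail a)
      (λ _ _ → subst (λ t → Adj (coRail a) (suc a , t)) (not-involutive (parity a)) (right a (not (parity a)) (s≤s (subst (a <_) eq (m<m+n a (s≤s z≤n))))))
      (λ i r q → rightStrip-across (suc a) i r) (λ i r q → rightStrip-forward (suc a) i r (column< q)) (λ i r q → rightStrip-backward (suc a) i r (column< q))
    split : coRail a ∷ corridor strip (suc D') D' (parity a) ++ applyUpTo coRail a
          ≡ (coRail a ∷ ys) ++ strip D' (parity D' xor not (parity a)) ∷ applyUpTo coRail a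
    split = cong (coRail a ∷_) (trans (cong (_++ applyUpTo coRail a) ys-last) (++-assoc ys _ (applyUpTo coRail a)))

  module ZigzagPathGood (a : ℕ) (2≤a : 2 ≤ a) (a≤top : a ≤ top) (pa : parity a ≡ false) where

    D : ℕ
    D = top ∸ a

    strip : ℕ → Bool → Node
    strip = rightStrip (suc a)

    a+D≡top : a + D ≡ top
    a+D≡top = m+[n∸m]≡n a≤top

    a<h : suc a ≤ h
    a<h = s≤s a≤top

    linked : Linked Adj (zigzagPath a)
    linked = linked-applyUpTo-++ rail a _ (rail-linked (suc a) a<h)
      (rung a (parity a) ∷ zigzagPath-tail-linked a D (≤-trans (s≤s z≤n) 2≤a) pa a+D≡top)

    column< : ∀ {i} → i < D → i + suc a < h
    column< {i} q = s≤s (subst (i + suc a ≤_) (trans (+-comm D a) a+D≡top) (subst (_≤ D + a) (sym (+-suc i a)) (+-monoˡ-≤ a q)))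

    onRail : ∀ v → v ∈ applyUpTo rail (suc a) → ∃ λ i → i < suc a × v ≡ rail i
    onRail v m = ∈-applyUpTo⁻ rail m

    onCoRail : ∀ v → v ∈ applyUpTo coRail a → ∃ λ i → i < a × v ≡ coRail i
    onCoRail v m = ∈-applyUpTo⁻ coRail m

    onStrip : ∀ v → v ∈ corridor strip D (D ∸ 1) (parity a) → InStrip D strip v
    onStrip v m = ∈-corridor⁻ strip D (D ∸ 1) (parity a) v m

    ≢strip : ∀ {i j r s} → i < suc a → (i , s) ≢ strip j r
    ≢strip {i} {j} p e = <-irrefl (cong proj₁ e) (≤-trans p (m≤n+m (suc a) j))

    onTail : ∀ v → v ∈ coRail a ∷ (corridor strip D (D ∸ 1) (parity a) ++ applyUpTo coRail a)
      → v ≡ coRail a ⊎ (InStrip D strip v ⊎ ∃ λ i → i < a × v ≡ coRail i)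
    onTail v (here e) = inj₁ e
    onTail v (there m) = inj₂ (∈-++-by _ onStrip onCoRail v m)

    unique-tail-part : Unique (coRail a ∷ (corridor strip D (D ∸ 1) (parity a) ++ applyUpTo coRail a))
    unique-tail-part = All.tabulate (λ {v} m → coRail-a≢ v m)
      ∷ unique-++ (corridor-unique strip D (D ∸ 1) (parity a) (rightStrip-injective (suc a) D)) (coRail-unique a) onStrip onCoRail
          (λ v (j , r , q , e₁) (i , p , e₂) → ≢strip (m<n⇒m<1+n p) (trans (sym e₂) e₁))
      where
      coRail-a≢ : ∀ v → v ∈ corridor strip D (D ∸ 1) (parity a) ++ applyUpTo coRail a → coRail a ≢ v
      coRail-a≢ v m e with ∈-++-by _ onStrip onCoRail v m
      ... | inj₁ (j , r , q , e₂) = ≢strip ≤-refl (trans e e₂)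
      ... | inj₂ (i , p , e₂) = <-irrefl (sym (cong proj₁ (trans e e₂))) p

    unique : Unique (zigzagPath a)
    unique = subst Unique (applyUpTo-suc-++ rail a _) (unique-++ (rail-unique (suc a)) unique-tail-part onRail onTail
      (λ { v (i , p , e₁) (inj₁ e₂) → rail≢coRail i a (trans (sym e₁) e₂)
         ; v (i , p , e₁) (inj₂ (inj₁ (j , r , q , e₂))) → ≢strip p (trans (sym e₁) e₂)
         ; v (i , p , e₁) (inj₂ (inj₂ (j , q , e₂))) → rail≢coRail i j (trans (sym e₁) e₂) }))

    valid : ∀ v → v ∈ zigzagPath a → Valid v
    valid v m with ∈-++-by (applyUpTo rail (suc a)) onRail onTail v (subst (v ∈_) (sym (applyUpTo-suc-++ rail a _)) m)
    ... | inj₁ (i , p , refl) = ≤-trans p a<h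
    ... | inj₂ (inj₁ refl) = a<h
    ... | inj₂ (inj₂ (inj₁ (j , r , q , refl))) = column< q
    ... | inj₂ (inj₂ (inj₂ (i , p , refl))) = <-trans p a<h

    length≡ : length (zigzagPath a) ≡ h + h
    length≡ = trans (rail-length a _ (cong suc (trans (length-++ (corridor strip D (D ∸ 1) (parity a)))
                                      (cong₂ _+_ (length-corridor strip D (D ∸ 1) (parity a)) (length-applyUpTo coRail a)))))
      (trans (rearrange a D) (cong (λ t → suc t + suc t) a+D≡top))
      where
      rearrange : ∀ a d → suc (a + suc (d + d + a)) ≡ suc (a + d) + suc (a + d)
      rearrange = solve-∀

  zigzagPath-good : ∀ a → 2 ≤ a → a ≤ top → parity a ≡ false → GoodPath (zigzagPath a)
  zigzagPath-good a 2≤a a≤top pa = linked , unique , valid , length≡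
    where open ZigzagPathGood a 2≤a a≤top pa

  standard-good : ∀ p → Standard p → GoodPath p
  standard-good _ (rung-path k k<top) = rungPath-good k k<top
  standard-good _ (return-path a k _ k<D) = returnPath-good a k k<D
  standard-good _ hairpin-path = hairpinPath-good
  standard-good _ (zigzag-path a 2≤a a≤top pa) = zigzagPath-good a 2≤a a≤top pa
  standard-good _ (spiral-path e) = spiralPath-good e

  Visited : ℕ → Node → Set
  Visited a v = ∃ λ i → i < a × v ≡ rail i

  coRail-unvisited : ∀ a i → ¬ Visited a (coRail i)
  coRail-unvisited a i (j , _ , e) with cong proj₁ e
  ... | refl = not-≢ (parity i) (cong proj₂ e)

  spiral-case : ∀ b → parity top ≡ b → ∀ rest
    → Linked Adj ((0 , b) ∷ rest) → Unique (rail top ∷ (0 , b) ∷ rest)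
    → (∀ v → v ∈ rail top ∷ (0 , b) ∷ rest → Valid v × ¬ Visited top v)
    → (∀ v → Valid v → ¬ Visited top v → v ∈ rail top ∷ (0 , b) ∷ rest)
    → Standard (applyUpTo rail top ++ rail top ∷ (0 , b) ∷ rest)
  spiral-case false e rest lk u mem cov = ⊥-elim (proj₂ (mem _ (there (here refl))) (0 , s≤s z≤n , refl))
  spiral-case true e rest lk u mem cov =
    subst (λ t → Standard (applyUpTo rail top ++ rail top ∷ t)) (sym coRail-forced) (spiral-path (cong not e))
    where
    coRail-mem : ∀ v → v ∈ (0 , true) ∷ rest → ∃ λ i → i < h × v ≡ coRail i
    coRail-mem (c , s) m with mem _ (there m)
    ... | c<h , unvisited with ≡∨≡not s (parity c)
    ...   | inj₂ refl = c , c<h , refl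
    ...   | inj₁ refl with m≤n⇒m<n∨m≡n (≤-pred c<h)
    ...     | inj₁ c<top = ⊥-elim (unvisited (c , c<top , refl))
    ...     | inj₂ refl = ⊥-elim (unique-head≢ u m refl)
    coRail-cov : ∀ i → i < h → coRail i ∈ (0 , true) ∷ rest
    coRail-cov i i<h with cov (coRail i) i<h (coRail-unvisited top i)
    ... | there m = m
    ... | here e′ with cong proj₁ e′
    ...   | refl = ⊥-elim (not-≢ (parity i) (cong proj₂ e′))
    coRail-step : ∀ i j → i < h → j < h → Adj (coRail i) (coRail j) → j ≡ suc i ⊎ i ≡ suc j
    coRail-step i j _ _ a with coRail-adj i j a
    ... | inj₁ step = step
    ... | inj₂ (inj₁ (_ , _ , e′)) = ⊥-elim (not-≢ false (trans (sym e) e′))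
    ... | inj₂ (inj₂ (_ , _ , e′)) = ⊥-elim (not-≢ false (trans (sym e) e′))
    coRail-forced : (0 , true) ∷ rest ≡ applyUpTo coRail h
    coRail-forced = forced-path h coRail rest lk (unique-tail u) coRail-mem coRail-cov (λ i j _ _ e′ → cong proj₁ e′) coRail-step

  OnCoRail : ℕ → Node → Set
  OnCoRail a v = ∃ λ i → i < a × v ≡ coRail i

  Beyond : ℕ → Node → Set
  Beyond a v = ∃ λ c → ∃ λ s → a < c × c < h × v ≡ (c , s)

  module AfterRung (a : ℕ) (rest : List Node)
    (u : Unique (rail a ∷ coRail a ∷ rest))
    (mem : ∀ v → v ∈ rail a ∷ coRail a ∷ rest → Valid v × ¬ Visited a v)
    (cov : ∀ v → Valid v → ¬ Visited a v → v ∈ rail a ∷ coRail a ∷ rest) where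

    rest-classify : ∀ v → v ∈ rest → OnCoRail a v ⊎ Beyond a v
    rest-classify (c , s) m with mem _ (there (there m))
    ... | c<h , unvisited with <-cmp c a
    ...   | tri> _ _ a<c = inj₂ (c , s , a<c , c<h , refl)
    ...   | tri< c<a _ _ with ≡∨≡not s (parity c)
    ...     | inj₁ refl = ⊥-elim (unvisited (c , c<a , refl))
    ...     | inj₂ refl = inj₁ (c , c<a , refl)
    rest-classify (c , s) m | c<h , unvisited | tri≈ _ refl _ with ≡∨≡not s (parity c)
    ... | inj₁ refl = ⊥-elim (unique-head≢ u (there m) refl)
    ... | inj₂ refl = ⊥-elim (unique-head≢ (unique-tail u) m refl)

    coRail-∈-rest : ∀ i → i < a → coRail i ∈ rest
    coRail-∈-rest i i<a = ∈-drop₂ (cov (coRail i) (<-trans i<a (proj₁ (mem _ (here refl)))) (coRail-unvisited a i))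
      (λ e → <-irrefl (cong proj₁ e) i<a) (λ e → <-irrefl (cong proj₁ e) i<a)

    beyond-∈-rest : ∀ c s → a < c → c < h → (c , s) ∈ rest
    beyond-∈-rest c s a<c c<h = ∈-drop₂ (cov (c , s) c<h unvisited)
      (λ e → <-irrefl (sym (cong proj₁ e)) a<c) (λ e → <-irrefl (sym (cong proj₁ e)) a<c)
      where
      unvisited : ¬ Visited a (c , s)
      unvisited (i , i<a , e) = <-irrefl (sym (cong proj₁ e)) (<-trans i<a a<c)

  hairpin-case : ∀ c rest → suc c ≡ top
    → Linked Adj (coRail c ∷ rest) → Unique (rail (suc c) ∷ coRail (suc c) ∷ coRail c ∷ rest)
    → (∀ v → v ∈ rail (suc c) ∷ coRail (suc c) ∷ coRail c ∷ rest → Valid v × ¬ Visited (suc c) v)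
    → (∀ v → Valid v → ¬ Visited (suc c) v → v ∈ rail (suc c) ∷ coRail (suc c) ∷ coRail c ∷ rest)
    → Standard (applyUpTo rail (suc c) ++ rail (suc c) ∷ coRail (suc c) ∷ coRail c ∷ rest)
  hairpin-case c rest refl lk u mem cov =
    subst (λ t → Standard (applyUpTo rail top ++ rail top ∷ coRail top ∷ t)) (sym coRail-forced) hairpin-path
    where
    open AfterRung top (coRail c ∷ rest) u mem cov
    back-mem : ∀ v → v ∈ coRail c ∷ rest → ∃ λ t → t < top × v ≡ coRail (top ∸ suc t)
    back-mem v m with rest-classify v m
    ... | inj₁ (i , i<top , refl) = top ∸ suc i , mirror< i<top , cong coRail (sym (mirror-involutive i<top))
    ... | inj₂ (c' , s , top<c' , c'<h , refl) = ⊥-elim (<⇒≱ top<c' (≤-pred c'<h))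
    coRail-forced : coRail c ∷ rest ≡ applyDownFrom coRail (suc c)
    coRail-forced = trans (forced-path top (λ t → coRail (top ∸ suc t)) rest lk (unique-tail (unique-tail u)) back-mem
                             (λ t p → coRail-∈-rest _ (mirror< p)) (λ i j p q e → mirror-injective p q (cong proj₁ e))
                             (λ i j → coRail-adj-mirrored ≤-refl))
                          (applyUpTo-∸≡applyDownFrom coRail top)

  -- Turning back along the coRail, the path can only leave the columns ≤ a through the wrap from
  -- (0 , true) to (top , true); what is left after that is the strip of columns beyond a, seen from the left.
  module ReturnCase (c d' : ℕ) (rest : List Node) (eq : suc c + suc d' ≡ top)
    (lk : Linked Adj (coRail c ∷ rest)) (u : Unique (rail (suc c) ∷ coRail (suc c) ∷ coRail c ∷ rest))
    (mem : ∀ v → v ∈ rail (suc c) ∷ coRail (suc c) ∷ coRail c ∷ rest → Valid v × ¬ Visited (suc c) v)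
    (cov : ∀ v → Valid v → ¬ Visited (suc c) v → v ∈ rail (suc c) ∷ coRail (suc c) ∷ coRail c ∷ rest) where

    a D : ℕ
    a = suc c
    D = suc d'

    open AfterRung a (coRail c ∷ rest) u mem cov

    a<top : a < top
    a<top = subst (a <_) eq (m<m+n a (s≤s z≤n))

    D≤top : D ≤ top
    D≤top = subst (D ≤_) eq (m≤n+m D a)

    top∸a≡D : top ∸ a ≡ D
    top∸a≡D = trans (cong (_∸ a) (sym eq)) (m+n∸m≡n a D)

    top∸D≡a : top ∸ D ≡ a
    top∸D≡a = trans (cong (_∸ D) (sym eq)) (m+n∸n≡m a D)

    crossing : ∀ x y → OnCoRail a x → Beyond a y → Adj x y → x ≡ (0 , true) × y ≡ (top , true)
    crossing x y (i , i<a , refl) (c' , s , a<c' , c'<h , refl) adj with adj-view adj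
    ... | rung≡ e = ⊥-elim (<-asym i<a (subst (a <_) (cong proj₁ e) a<c'))
    ... | right≡ _ e = ⊥-elim (<⇒≱ a<c' (subst (_≤ a) (sym (cong proj₁ e)) i<a))
    ... | left≡ j e₁ e₂ = ⊥-elim (<-asym a<c' (subst (_< a) (sym (cong proj₁ e₂)) (<⇒≤ (subst (_< a) e₁ i<a))))
    ... | wrapR≡ e₁ e₂ = ⊥-elim (<-irrefl e₁ (<-trans i<a a<top))
    ... | wrapL≡ refl e₂ = refl , e₂

    module Split (q₁ p₂ : List Node) (split : coRail c ∷ rest ≡ (coRail c ∷ q₁) ++ p₂)
      (before : All (OnCoRail a) (coRail c ∷ q₁)) (after : All (Beyond a) p₂) where

      lk′ : Linked Adj ((coRail c ∷ q₁) ++ p₂)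
      lk′ = subst (Linked Adj) split lk

      u′ : Unique ((coRail c ∷ q₁) ++ p₂)
      u′ = subst Unique split (unique-tail (unique-tail u))

      ∈-before : ∀ {v} → v ∈ coRail c ∷ rest → OnCoRail a v → v ∈ coRail c ∷ q₁
      ∈-before {v} m (i , i<a , refl) with ∈-++⁻ (coRail c ∷ q₁) (subst (v ∈_) split m)
      ... | inj₁ m′ = m′
      ... | inj₂ m′ with All.lookup after m′
      ...   | (c' , s , a<c' , _ , e) = ⊥-elim (<-asym a<c' (subst (_< a) (cong proj₁ e) i<a))

      coRail-forced : coRail c ∷ q₁ ≡ applyDownFrom coRail a
      coRail-forced = trans
        (forced-path a (λ t → coRail (a ∸ suc t)) q₁ (linked-++⁻ˡ (coRail c) q₁ p₂ lk′) (unique-++⁻ˡ (coRail c ∷ q₁) p₂ u′)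
           back-mem (λ t p → ∈-before (coRail-∈-rest _ (mirror< p)) (_ , mirror< p , refl))
           (λ i j p q e → mirror-injective p q (cong proj₁ e)) (λ i j → coRail-adj-mirrored (<⇒≤ a<top)))
        (applyUpTo-∸≡applyDownFrom coRail a)
        where
        back-mem : ∀ v → v ∈ coRail c ∷ q₁ → ∃ λ t → t < a × v ≡ coRail (a ∸ suc t)
        back-mem v m with All.lookup before m
        ... | (i , i<a , refl) = a ∸ suc i , mirror< i<a , cong coRail (sym (mirror-involutive i<a))

      top-in-after : (top , true) ∈ p₂
      top-in-after with ∈-++⁻ (coRail c ∷ q₁) (subst ((top , true) ∈_) split (beyond-∈-rest top true a<top (n<1+n top)))
      ... | inj₂ m = m
      ... | inj₁ m with All.lookup before m
      ...   | (i , i<a , e) = ⊥-elim (<-irrefl (sym (cong proj₁ e)) (<-trans i<a a<top))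

      after-corridor : ∀ p₂′ → p₂ ≡ (top , true) ∷ p₂′ → ∃ λ k → k < D × p₂ ≡ corridor leftStrip D k true
      after-corridor p₂′ refl = corridor-complete D leftStrip true p₂′ (leftStrip-injective D D≤top)
        (λ i j r r' p q → leftStrip-step i j r r' (≤-trans p D≤top) (≤-trans q D≤top))
        (linked-++⁻ʳ (coRail c ∷ q₁) p₂ lk′) (unique-++⁻ʳ (coRail c ∷ q₁) p₂ u′) strip-mem strip-cov
        where
        strip-mem : ∀ v → v ∈ p₂ → InStrip D leftStrip v
        strip-mem v m with All.lookup after m
        ... | (c' , s , a<c' , c'<h , refl) =
          top ∸ c' , parity (top ∸ c') xor s , subst (top ∸ c' <_) top∸a≡D (∸-monoʳ-< a<c' (≤-pred c'<h)) ,
          cong₂ _,_ (sym (mirror-involutive c'<h)) (sym (xor-cancelˡ (parity (top ∸ c')) s))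
        strip-cov : ∀ i r → i < D → leftStrip i r ∈ p₂
        strip-cov i r p with ∈-++⁻ (coRail c ∷ q₁) (subst (leftStrip i r ∈_) split
                                (beyond-∈-rest (h ∸ suc i) (parity i xor r) a<column (mirror< (m<n⇒m<1+n (≤-trans p D≤top)))))
          where
          a<column : a < h ∸ suc i
          a<column = subst (_< top ∸ i) top∸D≡a (∸-monoʳ-< p D≤top)
        ... | inj₂ m = m
        ... | inj₁ m with All.lookup before m
        ...   | (j , j<a , e) = ⊥-elim (<-asym (subst (_< top ∸ i) top∸D≡a (∸-monoʳ-< p D≤top)) (subst (_< a) (sym (cong proj₁ e)) j<a))

  return-case : ∀ d' c rest → suc c + suc d' ≡ top
    → Linked Adj (coRail c ∷ rest) → Unique (rail (suc c) ∷ coRail (suc c) ∷ coRail c ∷ rest)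
    → (∀ v → v ∈ rail (suc c) ∷ coRail (suc c) ∷ coRail c ∷ rest → Valid v × ¬ Visited (suc c) v)
    → (∀ v → Valid v → ¬ Visited (suc c) v → v ∈ rail (suc c) ∷ coRail (suc c) ∷ coRail c ∷ rest)
    → Standard (applyUpTo rail (suc c) ++ rail (suc c) ∷ coRail (suc c) ∷ coRail c ∷ rest)
  return-case d' c rest eq lk u mem cov
    with first-crossing (OnCoRail (suc c)) (Beyond (suc c)) (0 , true) (top , true) Adj-sym (coRail c) rest lk
           (unique-tail (unique-tail u)) (c , ≤-refl , refl) (AfterRung.rest-classify (suc c) (coRail c ∷ rest) u mem cov)
           (ReturnCase.crossing c d' rest eq lk u mem cov)
  ... | q₁ , p₂ , split , before , after , crossed = finish crossed
    where
    open ReturnCase c d' rest eq lk u mem cov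
    open Split q₁ p₂ split before after
    finish : p₂ ≡ [] ⊎ (∃ λ p₁′ → ∃ λ p₂′ → coRail c ∷ q₁ ≡ p₁′ ++ [ (0 , true) ] × p₂ ≡ (top , true) ∷ p₂′)
      → Standard (applyUpTo rail a ++ rail a ∷ coRail a ∷ coRail c ∷ rest)
    finish (inj₁ refl) with top-in-after
    ... | ()
    finish (inj₂ (_ , p₂′ , _ , p₂≡)) with after-corridor p₂′ p₂≡
    ... | k , k<D , p₂-corridor =
      subst (λ t → Standard (applyUpTo rail a ++ rail a ∷ coRail a ∷ t)) (sym path≡)
        (return-path a k (s≤s z≤n) (subst (k <_) (sym top∸a≡D) k<D))
      where
      path≡ : coRail c ∷ rest ≡ applyDownFrom coRail a ++ corridor leftStrip (top ∸ a) k true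
      path≡ = trans split (cong₂ _++_ coRail-forced (trans p₂-corridor (cong (λ L → corridor leftStrip L k true) (sym top∸a≡D))))

  -- Going on to the right after the rung at a, the path sweeps the strip of columns beyond a and can only
  -- return through the wrap from (top , true) to (0 , true); so the strip is traversed by a full zigzag,
  -- which ends on the right side only for even a.
  module ZigzagCase (d' a : ℕ) (rest : List Node) (eq : a + suc d' ≡ top) (1≤a : 1 ≤ a)
    (lk : Linked Adj ((suc a , parity a) ∷ rest)) (u : Unique (rail a ∷ coRail a ∷ (suc a , parity a) ∷ rest))
    (mem : ∀ v → v ∈ rail a ∷ coRail a ∷ (suc a , parity a) ∷ rest → Valid v × ¬ Visited a v)
    (cov : ∀ v → Valid v → ¬ Visited a v → v ∈ rail a ∷ coRail a ∷ (suc a , parity a) ∷ rest) where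

    D : ℕ
    D = suc d'

    open AfterRung a ((suc a , parity a) ∷ rest) u mem cov

    a<top : a < top
    a<top = subst (a <_) eq (m<m+n a (s≤s z≤n))

    top∸a≡D : top ∸ a ≡ D
    top∸a≡D = trans (cong (_∸ a) (sym eq)) (m+n∸m≡n a D)

    first-beyond : Beyond a (suc a , parity a)
    first-beyond = suc a , parity a , ≤-refl , s≤s a<top , refl

    crossing : ∀ x y → Beyond a x → OnCoRail a y → Adj x y → x ≡ (top , true) × y ≡ (0 , true)
    crossing x y (c' , s , a<c' , c'<h , refl) (i , i<a , refl) adj with adj-view adj
    ... | rung≡ e = ⊥-elim (<-asym i<a (subst (a <_) (sym (cong proj₁ e)) a<c'))
    ... | right≡ _ e = ⊥-elim (<-asym i<a (subst (a <_) (sym (cong proj₁ e)) (<-trans a<c' (n<1+n c'))))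
    ... | left≡ j e₁ e₂ = ⊥-elim (<⇒≱ a<c' (subst (_≤ a) (sym (trans e₁ (cong suc (sym (cong proj₁ e₂))))) i<a))
    ... | wrapL≡ e₁ _ = ⊥-elim (<-irrefl (sym e₁) (≤-trans (s≤s z≤n) a<c'))
    ... | wrapR≡ refl e₂ with cong proj₁ e₂
    ...   | refl = cong (top ,_) (sym (cong proj₂ e₂)) , refl

    module Split (q₁ p₂ : List Node) (split : (suc a , parity a) ∷ rest ≡ ((suc a , parity a) ∷ q₁) ++ p₂)
      (before : All (Beyond a) ((suc a , parity a) ∷ q₁)) (after : All (OnCoRail a) p₂) where

      lk′ : Linked Adj (((suc a , parity a) ∷ q₁) ++ p₂)
      lk′ = subst (Linked Adj) split lk

      u′ : Unique (((suc a , parity a) ∷ q₁) ++ p₂)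
      u′ = subst Unique split (unique-tail (unique-tail u))

      column< : ∀ i → i < D → i + suc a < h
      column< i p = s≤s (subst (i + suc a ≤_) (trans (+-suc d' a) (trans (cong suc (+-comm d' a)) (trans (sym (+-suc a d')) eq)))
                                (+-monoˡ-≤ (suc a) (≤-pred p)))

      before-corridor : ∃ λ k → k < D × (suc a , parity a) ∷ q₁ ≡ corridor (rightStrip (suc a)) D k (parity a)
      before-corridor = corridor-complete D (rightStrip (suc a)) (parity a) q₁ (rightStrip-injective (suc a) D)
        (λ i j r r' p q adj → rightStrip-step (suc a) i j r r' (s≤s z≤n) adj)
        (linked-++⁻ˡ (suc a , parity a) q₁ p₂ lk′) (unique-++⁻ˡ ((suc a , parity a) ∷ q₁) p₂ u′) strip-mem strip-cov
        where
        strip-mem : ∀ v → v ∈ (suc a , parity a) ∷ q₁ → InStrip D (rightStrip (suc a)) v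
        strip-mem v m with All.lookup before m
        ... | (c' , s , a<c' , c'<h , refl) =
          c' ∸ suc a , parity (c' ∸ suc a) xor s , subst (c' ∸ suc a <_) top∸a≡D (∸-monoˡ-< c'<h a<c') ,
          cong₂ _,_ (sym (m∸n+n≡m a<c')) (sym (xor-cancelˡ (parity (c' ∸ suc a)) s))
        strip-cov : ∀ i r → i < D → rightStrip (suc a) i r ∈ (suc a , parity a) ∷ q₁
        strip-cov i r p with ∈-++⁻ ((suc a , parity a) ∷ q₁)
                               (subst (rightStrip (suc a) i r ∈_) split (beyond-∈-rest (i + suc a) (parity i xor r) (m≤n+m (suc a) i) (column< i p)))
        ... | inj₁ m = m
        ... | inj₂ m with All.lookup after m
        ...   | (j , j<a , e) = ⊥-elim (<-asym j<a (subst (a <_) (cong proj₁ e) (m≤n+m (suc a) i)))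

      zero-in-after : (0 , true) ∈ p₂
      zero-in-after with ∈-++⁻ ((suc a , parity a) ∷ q₁) (subst ((0 , true) ∈_) split (coRail-∈-rest 0 1≤a))
      ... | inj₂ m = m
      ... | inj₁ m with All.lookup before m
      ...   | (c' , s , a<c' , _ , e) = ⊥-elim (<-irrefl (cong proj₁ e) (≤-trans (s≤s z≤n) a<c'))

      coRail-forced : ∀ p₂′ → p₂ ≡ (0 , true) ∷ p₂′ → p₂ ≡ applyUpTo coRail a
      coRail-forced p₂′ refl = forced-path a coRail p₂′ (linked-++⁻ʳ ((suc a , parity a) ∷ q₁) p₂ lk′)
        (unique-++⁻ʳ ((suc a , parity a) ∷ q₁) p₂ u′) (λ v m → All.lookup after m) coRail-cov
        (λ i j _ _ e → cong proj₁ e) (λ i j → coRail-adj-below (<⇒≤ a<top))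
        where
        coRail-cov : ∀ i → i < a → coRail i ∈ p₂
        coRail-cov i p with ∈-++⁻ ((suc a , parity a) ∷ q₁) (subst (coRail i ∈_) split (coRail-∈-rest i p))
        ... | inj₂ m = m
        ... | inj₁ m with All.lookup before m
        ...   | (c' , s , a<c' , _ , e) = ⊥-elim (<-asym p (subst (a <_) (sym (cong proj₁ e)) a<c'))

      -- The corridor ends at column k of the strip, i.e. at column k + a + 1 = top; so it is the full
      -- zigzag, and its last node lies on side parity d' xor not (parity a), which must be true.
      full-zigzag : ∀ k p₁′ → (suc a , parity a) ∷ q₁ ≡ corridor (rightStrip (suc a)) D k (parity a) → k < D
        → (suc a , parity a) ∷ q₁ ≡ p₁′ ++ [ (top , true) ] → k ≡ d' × parity a ≡ false
      full-zigzag k p₁′ q≡corridor k<D q≡p₁′ = k≡d' , parity-a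
        where
        last-node : ∃ λ r → (top , true) ≡ rightStrip (suc a) k r
        last-node with corridor-last (rightStrip (suc a)) D k (parity a) k<D
        ... | ys , r , ends = r , proj₂ (∷ʳ-injective p₁′ ys (trans (sym q≡p₁′) (trans q≡corridor ends)))
        k≡d' : k ≡ d'
        k≡d' = +-cancelʳ-≡ (suc a) k d' (trans (sym (cong proj₁ (proj₂ last-node)))
                 (trans (sym eq) (trans (+-suc a d') (trans (cong suc (+-comm a d')) (sym (+-suc d' a))))))
        last-side : (top , true) ≡ rightStrip (suc a) d' (parity d' xor not (parity a))
        last-side with corridor-full-last (rightStrip (suc a)) d' (parity a)
        ... | ys , ends = proj₂ (∷ʳ-injective p₁′ ys (trans (sym q≡p₁′)
                            (trans q≡corridor (trans (cong (λ t → corridor (rightStrip (suc a)) D t (parity a)) k≡d') ends))))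
        parity-a : parity a ≡ false
        parity-a = trans (sym (not-involutive (parity a)))
                     (cong not (sym (trans (cong proj₂ last-side) (xor-cancelˡ (parity d') (not (parity a))))))

  zigzag-case : ∀ d' a rest → a + suc d' ≡ top → 1 ≤ a
    → Linked Adj ((suc a , parity a) ∷ rest) → Unique (rail a ∷ coRail a ∷ (suc a , parity a) ∷ rest)
    → (∀ v → v ∈ rail a ∷ coRail a ∷ (suc a , parity a) ∷ rest → Valid v × ¬ Visited a v)
    → (∀ v → Valid v → ¬ Visited a v → v ∈ rail a ∷ coRail a ∷ (suc a , parity a) ∷ rest)
    → Standard (applyUpTo rail a ++ rail a ∷ coRail a ∷ (suc a , parity a) ∷ rest)
  zigzag-case d' a rest eq 1≤a lk u mem cov
    with first-crossing (Beyond a) (OnCoRail a) (top , true) (0 , true) Adj-sym (suc a , parity a) rest lk (unique-tail (unique-tail u))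
           (ZigzagCase.first-beyond d' a rest eq 1≤a lk u mem cov)
           (λ v m → ⊎-swap (AfterRung.rest-classify a ((suc a , parity a) ∷ rest) u mem cov v m))
           (ZigzagCase.crossing d' a rest eq 1≤a lk u mem cov)
  ... | q₁ , p₂ , split , before , after , crossed = finish crossed
    where
    open ZigzagCase d' a rest eq 1≤a lk u mem cov
    open Split q₁ p₂ split before after
    finish : p₂ ≡ [] ⊎ (∃ λ p₁′ → ∃ λ p₂′ → (suc a , parity a) ∷ q₁ ≡ p₁′ ++ [ (top , true) ] × p₂ ≡ (0 , true) ∷ p₂′)
      → Standard (applyUpTo rail a ++ rail a ∷ coRail a ∷ (suc a , parity a) ∷ rest)
    finish (inj₁ refl) with zero-in-after
    ... | ()
    finish (inj₂ (p₁′ , p₂′ , ends-top , p₂≡)) with before-corridor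
    ... | k , k<D , q≡corridor with full-zigzag k p₁′ q≡corridor k<D ends-top
    ...   | refl , parity-a =
      subst (λ t → Standard (applyUpTo rail a ++ rail a ∷ coRail a ∷ t)) (sym path≡)
        (zigzag-path a (even⇒2≤ a 1≤a parity-a) (<⇒≤ a<top) parity-a)
      where
      path≡ : (suc a , parity a) ∷ rest ≡ corridor (rightStrip (suc a)) (top ∸ a) (top ∸ a ∸ 1) (parity a) ++ applyUpTo coRail a
      path≡ = trans split (cong₂ _++_ (trans q≡corridor (cong (λ L → corridor (rightStrip (suc a)) L (L ∸ 1) (parity a)) (sym top∸a≡D)))
                                      (coRail-forced p₂′ p₂≡))

  wrap-zigzag-case : ∀ b → parity top ≡ b → ∀ rest
    → Linked Adj ((0 , not b) ∷ rest) → Unique (rail top ∷ coRail top ∷ (0 , not b) ∷ rest)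
    → (∀ v → v ∈ rail top ∷ coRail top ∷ (0 , not b) ∷ rest → Valid v × ¬ Visited top v)
    → (∀ v → Valid v → ¬ Visited top v → v ∈ rail top ∷ coRail top ∷ (0 , not b) ∷ rest)
    → Standard (applyUpTo rail top ++ rail top ∷ coRail top ∷ (0 , not b) ∷ rest)
  wrap-zigzag-case true e rest lk u mem cov = ⊥-elim (proj₂ (mem _ (there (there (here refl)))) (0 , s≤s z≤n , refl))
  wrap-zigzag-case false e rest lk u mem cov =
    subst (λ t → Standard (applyUpTo rail top ++ rail top ∷ coRail top ∷ t)) (sym coRail-forced)
      (subst (λ L → Standard (applyUpTo rail top ++ rail top ∷ coRail top ∷ corridor (rightStrip (suc top)) L (L ∸ 1) (parity top) ++ applyUpTo coRail top))
             (n∸n≡0 top) (zigzag-path top (s≤s (s≤s z≤n)) ≤-refl e))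
    where
    open AfterRung top ((0 , true) ∷ rest) u mem cov
    coRail-mem : ∀ v → v ∈ (0 , true) ∷ rest → ∃ λ i → i < top × v ≡ coRail i
    coRail-mem v m with rest-classify v m
    ... | inj₁ onCoRail = onCoRail
    ... | inj₂ (c' , s , top<c' , c'<h , _) = ⊥-elim (<⇒≱ top<c' (≤-pred c'<h))
    coRail-forced : (0 , true) ∷ rest ≡ applyUpTo coRail top
    coRail-forced = forced-path top coRail rest lk (unique-tail (unique-tail u)) coRail-mem coRail-∈-rest
                      (λ i j _ _ e′ → cong proj₁ e′) (λ i j → coRail-adj-below ≤-refl)

  after-rung : ∀ d a rest → a + d ≡ top → 1 ≤ a
    → Linked Adj (coRail a ∷ rest) → Unique (rail a ∷ coRail a ∷ rest)
    → (∀ v → v ∈ rail a ∷ coRail a ∷ rest → Valid v × ¬ Visited a v)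
    → (∀ v → Valid v → ¬ Visited a v → v ∈ rail a ∷ coRail a ∷ rest)
    → Standard (applyUpTo rail a ++ rail a ∷ coRail a ∷ rest)
  after-rung d a [] eq 1≤a lk u mem cov with cov (coRail 0) (s≤s z≤n) (coRail-unvisited a 0)
  ... | here e = ⊥-elim (<-irrefl (cong proj₁ e) 1≤a)
  ... | there (here e) = ⊥-elim (<-irrefl (cong proj₁ e) 1≤a)
  after-rung d a (z ∷ rest) eq 1≤a (adj ∷ lk) u mem cov with adj-view adj
  ... | rung≡ e = ⊥-elim (unique-head≢ u (there (here refl)) (sym (trans e (cong (a ,_) (not-involutive (parity a))))))
  ... | wrapL≡ refl _ = ⊥-elim (<-irrefl refl 1≤a)
  ... | wrapR≡ refl refl = wrap-zigzag-case (parity top) refl rest lk u mem cov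
  ... | right≡ a<top e with trans e (cong (suc a ,_) (not-involutive (parity a)))
  ...   | refl = onward d eq
    where
    onward : ∀ d → a + d ≡ top → Standard (applyUpTo rail a ++ rail a ∷ coRail a ∷ (suc a , parity a) ∷ rest)
    onward zero eq′ = ⊥-elim (<-irrefl (cong suc (trans (sym (+-identityʳ a)) eq′)) a<top)
    onward (suc d') eq′ = zigzag-case d' a rest eq′ 1≤a lk u mem cov
  after-rung d a (z ∷ rest) eq 1≤a (adj ∷ lk) u mem cov | left≡ c refl e₂ with trans e₂ (cong (c ,_) (not-involutive (parity (suc c))))
  ... | refl = back d eq
    where
    back : ∀ d → suc c + d ≡ top → Standard (applyUpTo rail (suc c) ++ rail (suc c) ∷ coRail (suc c) ∷ coRail c ∷ rest)
    back zero eq′ = hairpin-case c rest (trans (sym (+-identityʳ (suc c))) eq′) lk u mem cov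
    back (suc d') eq′ = return-case d' c rest eq′ lk u mem cov

  along-rail : ∀ d a rest → a + d ≡ top → 1 ≤ a
    → Linked Adj (rail a ∷ rest) → Unique (rail a ∷ rest)
    → (∀ v → v ∈ rail a ∷ rest → Valid v × ¬ Visited a v)
    → (∀ v → Valid v → ¬ Visited a v → v ∈ rail a ∷ rest)
    → Standard (applyUpTo rail a ++ rail a ∷ rest)
  along-rail d a [] eq 1≤a lk u mem cov with cov (coRail 0) (s≤s z≤n) (coRail-unvisited a 0)
  ... | here e = ⊥-elim (<-irrefl (cong proj₁ e) 1≤a)
  along-rail d a (y ∷ rest) eq 1≤a (adj ∷ lk) u mem cov with adj-view adj
  ... | rung≡ refl = after-rung d a rest eq 1≤a lk u mem cov
  ... | left≡ c refl refl = ⊥-elim (proj₂ (mem _ (there (here refl))) (c , ≤-refl , cong (c ,_) (not-involutive (parity c))))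
  ... | wrapL≡ refl _ = ⊥-elim (<-irrefl refl 1≤a)
  ... | wrapR≡ refl refl = spiral-case (parity top) refl rest lk u mem cov
  ... | right≡ a<top refl = onward d eq
    where
    onward : ∀ d → a + d ≡ top → Standard (applyUpTo rail a ++ rail a ∷ rail (suc a) ∷ rest)
    onward zero eq′ = ⊥-elim (<-irrefl (cong suc (trans (sym (+-identityʳ a)) eq′)) a<top)
    onward (suc d') eq′ = subst Standard (applyUpTo-suc-++ rail a (rail (suc a) ∷ rest))
      (along-rail d' (suc a) rest (trans (sym (+-suc a d')) eq′) (s≤s z≤n) lk (unique-tail u) mem′ cov′)
      where
      mem′ : ∀ v → v ∈ rail (suc a) ∷ rest → Valid v × ¬ Visited (suc a) v
      mem′ v m with mem v (there m)
      ... | valid , unvisited = valid , not-visited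
        where
        not-visited : ¬ Visited (suc a) v
        not-visited (i , i<1+a , e) with m≤n⇒m<n∨m≡n (≤-pred i<1+a)
        ... | inj₁ i<a = unvisited (i , i<a , e)
        ... | inj₂ refl = unique-head≢ u m (sym e)
      cov′ : ∀ v → Valid v → ¬ Visited (suc a) v → v ∈ rail (suc a) ∷ rest
      cov′ v valid unvisited with cov v valid (λ (i , i<a , e) → unvisited (i , m<n⇒m<1+n i<a , e))
      ... | here e = ⊥-elim (unvisited (a , ≤-refl , e))
      ... | there m = m

  Hamiltonian : List Node → Set
  Hamiltonian q = Linked Adj q × Unique q × (∀ v → v ∈ q → Valid v) × (∀ v → Valid v → v ∈ q)

  Rightward : List Node → Set
  Rightward q = (∃ λ rest → q ≡ (0 , false) ∷ (1 , true) ∷ rest) ⊎ (∃ λ rest → q ≡ (0 , false) ∷ (0 , true) ∷ (1 , false) ∷ rest)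

  rung-case : ∀ rest → Hamiltonian ((0 , false) ∷ (0 , true) ∷ (1 , false) ∷ rest) → Standard ((0 , false) ∷ (0 , true) ∷ (1 , false) ∷ rest)
  rung-case rest (_ ∷ _ ∷ lk , u , valid , cov) with
    corridor-complete top (rightStrip 1) false rest (rightStrip-injective 1 top) (λ i j r r' p q adj → rightStrip-step 1 i j r r' (s≤s z≤n) adj)
      lk (unique-tail (unique-tail u)) strip-mem strip-cov
    where
    strip-mem : ∀ v → v ∈ (1 , false) ∷ rest → InStrip top (rightStrip 1) v
    strip-mem (zero , s) m with ≡∨≡not s false
    ... | inj₁ refl = ⊥-elim (unique-head≢ u (there m) refl)
    ... | inj₂ refl = ⊥-elim (unique-head≢ (unique-tail u) m refl)
    strip-mem (suc i , s) m = i , parity i xor s , ≤-pred (valid _ (there (there m))) , cong₂ _,_ (+-comm 1 i) (sym (xor-cancelˡ (parity i) s))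
    strip-cov : ∀ i r → i < top → rightStrip 1 i r ∈ (1 , false) ∷ rest
    strip-cov i r p = ∈-drop₂ (cov _ (subst (_< h) (+-comm 1 i) (s≤s p)))
      (λ e → 1+n≢0 (trans (+-comm 1 i) (cong proj₁ e))) (λ e → 1+n≢0 (trans (+-comm 1 i) (cong proj₁ e)))
  ... | k , k<top , eq = subst (λ t → Standard ((0 , false) ∷ (0 , true) ∷ t)) (sym eq) (rung-path k k<top)

  rightward-standard : ∀ q → Hamiltonian q → Rightward q → Standard q
  rightward-standard _ hq (inj₂ (rest , refl)) = rung-case rest hq
  rightward-standard _ (_ ∷ lk , u , valid , cov) (inj₁ (rest , refl)) = along-rail (suc m) 1 rest refl (s≤s z≤n) lk (unique-tail u) mem′ cov′
    where
    mem′ : ∀ v → v ∈ (1 , true) ∷ rest → Valid v × ¬ Visited 1 v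
    mem′ v m = valid v (there m) , λ { (zero , _ , e) → unique-head≢ u m (sym e) ; (suc _ , s≤s () , _) }
    cov′ : ∀ v → Valid v → ¬ Visited 1 v → v ∈ (1 , true) ∷ rest
    cov′ v valid unvisited with cov v valid
    ... | here e = ⊥-elim (unvisited (0 , s≤s z≤n , e))
    ... | there m = m

  -- The reflection c ↦ h − c of the columns (mod h), which also swaps the sides off column 0: an
  -- automorphism fixing (0 , false) that turns a path leaving towards the last column into a Rightward one.
  σ : Node → Node
  σ (zero , s) = (zero , s)
  σ (suc c , s) = (top ∸ c , not s)

  top∸c≡suc : ∀ c → c < top → top ∸ c ≡ suc (suc m ∸ c)
  top∸c≡suc c p = +-∸-assoc 1 (≤-pred p)

  top∸[1+m]≡1 : top ∸ suc m ≡ 1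
  top∸[1+m]≡1 = m+n∸n≡m 1 m

  σ-valid : ∀ v → Valid v → Valid (σ v)
  σ-valid (zero , s) p = p
  σ-valid (suc c , s) p = s≤s (m∸n≤m top c)

  σ-involutive : ∀ v → Valid v → σ (σ v) ≡ v
  σ-involutive (zero , s) p = refl
  σ-involutive (suc c , s) p = trans (cong σ (cong₂ _,_ (top∸c≡suc c (≤-pred p)) refl))
    (cong₂ _,_ (trans (top∸c≡suc (suc m ∸ c) (s≤s (m∸n≤m (suc m) c))) (cong suc (m∸[m∸n]≡n (≤-pred (≤-pred p))))) (not-involutive s))

  σ-adj : ∀ u v → Adj u v → Adj (σ u) (σ v)
  σ-adj _ _ (rung zero s) = rung 0 s
  σ-adj _ _ (rung (suc c) s) = rung (top ∸ c) (not s)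
  σ-adj _ _ (right zero s p) = subst (λ t → Adj (0 , s) (top , t)) (sym (not-involutive s)) (wrapL s)
  σ-adj _ _ (right (suc c) s p) = subst (λ t → Adj (t , not s) (suc m ∸ c , not (not s))) (sym (top∸c≡suc c (≤-trans (n≤1+n _) (≤-pred p))))
    (left (suc m ∸ c) (not s) (s≤s (s≤s (m∸n≤m (suc m) c))))
  σ-adj _ _ (left zero s p) = wrapR (not s)
  σ-adj _ _ (left (suc c) s p) = subst (λ t → Adj (suc m ∸ c , not s) (t , not (not s))) (sym (top∸c≡suc c (≤-trans (n≤1+n _) (≤-pred p))))
    (right (suc m ∸ c) (not s) (s≤s (s≤s (m∸n≤m (suc m) c))))
  σ-adj _ _ (wrapR s) = subst₂ (λ t t' → Adj (t , not s) (0 , t')) (sym top∸[1+m]≡1) (not-involutive s) (left 0 (not s) (s≤s (s≤s z≤n)))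
  σ-adj _ _ (wrapL s) = subst (λ t → Adj (0 , s) (t , not s)) (sym top∸[1+m]≡1) (right 0 s (s≤s (s≤s z≤n)))

  σ-linked : ∀ q → Linked Adj q → Linked Adj (map σ q)
  σ-linked [] _ = []
  σ-linked (x ∷ []) _ = [-]
  σ-linked (x ∷ y ∷ q) (a ∷ l) = σ-adj x y a ∷ σ-linked (y ∷ q) l

  map-σ-involutive : ∀ q → (∀ v → v ∈ q → Valid v) → map σ (map σ q) ≡ q
  map-σ-involutive [] _ = refl
  map-σ-involutive (x ∷ q) valid = cong₂ _∷_ (σ-involutive x (valid x (here refl))) (map-σ-involutive q (λ v m → valid v (there m)))

  σ-unique : ∀ q → (∀ v → v ∈ q → Valid v) → Unique q → Unique (map σ q)
  σ-unique q valid u = Unique.map⁻ (subst Unique (sym (map-σ-involutive q valid)) u)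

  ∈-map-σ⁻ : ∀ {q} → (∀ v → v ∈ q → Valid v) → ∀ v → v ∈ map σ q → Valid v
  ∈-map-σ⁻ {q} valid v m with ∈-map⁻ σ m
  ... | x , m′ , refl = σ-valid x (valid x m′)

  σ-hamiltonian : ∀ q → Hamiltonian q → Hamiltonian (map σ q)
  σ-hamiltonian q (lk , u , valid , cov) = σ-linked q lk , σ-unique q valid u , ∈-map-σ⁻ valid , cov′
    where
    cov′ : ∀ v → Valid v → v ∈ map σ q
    cov′ v vv = subst (_∈ map σ q) (σ-involutive v vv) (∈-map⁺ σ (cov (σ v) (σ-valid v vv)))

  σ-good : ∀ p → GoodPath p → GoodPath (map σ p)
  σ-good p (lk , u , valid , len) = σ-linked p lk , σ-unique p valid u , ∈-map-σ⁻ valid , trans (length-map σ p) len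

  rightward-or-σ : ∀ rest → Hamiltonian ((0 , false) ∷ rest) → Rightward ((0 , false) ∷ rest) ⊎ Rightward (map σ ((0 , false) ∷ rest))
  rightward-or-σ [] (lk , u , valid , cov) with cov (0 , true) (s≤s z≤n)
  ... | here ()
  ... | there ()
  rightward-or-σ (y ∷ rest) (adj ∷ lk , u , valid , cov) with adj-view adj
  ... | right≡ _ refl = inj₁ (inj₁ (rest , refl))
  ... | wrapL≡ _ refl = inj₂ (inj₁ (map σ rest , cong (λ t → (0 , false) ∷ (t , true) ∷ map σ rest) top∸[1+m]≡1))
  ... | rung≡ refl = after-first-rung rest lk u cov
    where
    after-first-rung : ∀ rest → Linked Adj ((0 , true) ∷ rest) → Unique ((0 , false) ∷ (0 , true) ∷ rest)
      → (∀ v → Valid v → v ∈ (0 , false) ∷ (0 , true) ∷ rest)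
      → Rightward ((0 , false) ∷ (0 , true) ∷ rest) ⊎ Rightward (map σ ((0 , false) ∷ (0 , true) ∷ rest))
    after-first-rung [] _ _ cov with cov (1 , false) (s≤s (s≤s z≤n))
    ... | there (there ())
    after-first-rung (z ∷ rest) (adj ∷ _) u _ with adj-view adj
    ... | right≡ _ refl = inj₁ (inj₂ (rest , refl))
    ... | wrapL≡ _ refl = inj₂ (inj₂ (map σ rest , cong (λ t → (0 , false) ∷ (0 , true) ∷ (t , false) ∷ map σ rest) top∸[1+m]≡1))
    ... | rung≡ refl = ⊥-elim (unique-head≢ u (there (here refl)) refl)

  rail-prefix : ∀ a Y → 1 ≤ a → ∃ λ t → applyUpTo rail a ++ rail a ∷ Y ≡ rail 0 ∷ rail 1 ∷ t
  rail-prefix (suc zero) Y _ = Y , refl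
  rail-prefix (suc (suc a)) Y _ = _ , refl

  standard-rightward : ∀ p → Standard p → Rightward p
  standard-rightward _ (rung-path k _) with corridor-head (rightStrip 1) (suc m) k false
  ... | t , e = inj₂ (t , cong (λ x → (0 , false) ∷ (0 , true) ∷ x) e)
  standard-rightward _ (return-path a k 1≤a _) = inj₁ (rail-prefix a _ 1≤a)
  standard-rightward _ hairpin-path = inj₁ (rail-prefix top _ (s≤s z≤n))
  standard-rightward _ (zigzag-path a 2≤a _ _) = inj₁ (rail-prefix a _ (≤-trans (s≤s z≤n) 2≤a))
  standard-rightward _ (spiral-path _) = inj₁ (rail-prefix top _ (s≤s z≤n))

  rungPaths : List (List Node)
  rungPaths = applyUpTo rungPath top

  returnPathsAt : ℕ → List (List Node)
  returnPathsAt a′ = applyUpTo (returnPath (suc a′)) (suc m ∸ a′)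

  returnPaths : List (List Node)
  returnPaths = concat (applyUpTo returnPathsAt (suc m))

  zigzagPathAt : ℕ → List Node
  zigzagPathAt b = zigzagPath (suc (suc (b + b)))

  zigzagPaths : List (List Node)
  zigzagPaths = applyUpTo zigzagPathAt ⌊ top /2⌋

  spiralPathsIf : Bool → List (List Node)
  spiralPathsIf true = []
  spiralPathsIf false = spiralPath ∷ []

  spiralPaths : List (List Node)
  spiralPaths = spiralPathsIf (parity h)

  rightwardPaths : List (List Node)
  rightwardPaths = rungPaths ++ returnPaths ++ hairpinPath ∷ zigzagPaths ++ spiralPaths

  IsRung IsReturn IsHairpin IsZigzag IsSpiral : List Node → Set
  IsRung p = ∃ λ k → k < top × p ≡ rungPath k
  IsReturn p = ∃ λ a → ∃ λ k → 1 ≤ a × k < top ∸ a × p ≡ returnPath a k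
  IsHairpin p = p ≡ hairpinPath
  IsZigzag p = ∃ λ a → 2 ≤ a × a ≤ top × parity a ≡ false × p ≡ zigzagPath a
  IsSpiral p = parity h ≡ false × p ≡ spiralPath

  ∈-rungPaths⁻ : ∀ p → p ∈ rungPaths → IsRung p
  ∈-rungPaths⁻ p m = ∈-applyUpTo⁻ rungPath m

  ∈-returnPaths⁻ : ∀ p → p ∈ returnPaths → IsReturn p
  ∈-returnPaths⁻ p p∈ with ∈-concat⁻′ (applyUpTo returnPathsAt (suc m)) p∈
  ... | xs , m′ , m″ with ∈-applyUpTo⁻ returnPathsAt m″
  ...   | a′ , _ , refl with ∈-applyUpTo⁻ (returnPath (suc a′)) m′
  ...     | k , k<D , e = suc a′ , k , s≤s z≤n , k<D , e

  ∈-zigzagPaths⁻ : ∀ p → p ∈ zigzagPaths → IsZigzag p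
  ∈-zigzagPaths⁻ p m with ∈-applyUpTo⁻ zigzagPathAt m
  ... | b , b<⌊top/2⌋ , e = suc (suc (b + b)) , s≤s (s≤s z≤n) , b<⌊n/2⌋⇒2+b+b≤n b top b<⌊top/2⌋ ,
                           trans (not-involutive (parity (b + b))) (parity-double b) , e

  ∈-spiralPaths⁻ : ∀ p → p ∈ spiralPaths → IsSpiral p
  ∈-spiralPaths⁻ p m = spiral (parity h) refl m
    where
    spiral : ∀ b → parity h ≡ b → p ∈ spiralPathsIf b → IsSpiral p
    spiral false e (here refl) = e , refl

  ∈-rightwardPaths⁻ : ∀ p → p ∈ rightwardPaths → Standard p
  ∈-rightwardPaths⁻ p m with ∈-++⁻ rungPaths m
  ... | inj₁ m′ with ∈-rungPaths⁻ p m′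
  ...   | k , k<top , refl = rung-path k k<top
  ∈-rightwardPaths⁻ p m | inj₂ m′ with ∈-++⁻ returnPaths m′
  ... | inj₁ m″ with ∈-returnPaths⁻ p m″
  ...   | a , k , 1≤a , k<D , refl = return-path a k 1≤a k<D
  ∈-rightwardPaths⁻ p m | inj₂ m′ | inj₂ (here refl) = hairpin-path
  ∈-rightwardPaths⁻ p m | inj₂ m′ | inj₂ (there m″) with ∈-++⁻ zigzagPaths m″
  ... | inj₁ m‴ with ∈-zigzagPaths⁻ p m‴
  ...   | a , 2≤a , a≤top , pa , refl = zigzag-path a 2≤a a≤top pa
  ∈-rightwardPaths⁻ p m | inj₂ m′ | inj₂ (there m″) | inj₂ m‴ with ∈-spiralPaths⁻ p m‴
  ... | e , refl = spiral-path e

  ∸-positive⇒< : ∀ {a k} → k < top ∸ a → a < top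
  ∸-positive⇒< {a} {k} p = m∸n≢0⇒n<m (λ e → n≮0 (subst (k <_) e p))

  standard-∈ : ∀ p → Standard p → p ∈ rightwardPaths
  standard-∈ _ (rung-path k k<top) = ∈-++⁺ˡ (∈-applyUpTo⁺ rungPath k<top)
  standard-∈ _ (return-path (suc a′) k _ k<D) = ∈-++⁺ʳ rungPaths (∈-++⁺ˡ (∈-concat⁺′ (∈-applyUpTo⁺ (returnPath (suc a′)) k<D)
    (∈-applyUpTo⁺ returnPathsAt (≤-pred (∸-positive⇒< {suc a′} k<D)))))
  standard-∈ _ hairpin-path = ∈-++⁺ʳ rungPaths (∈-++⁺ʳ returnPaths (here refl))
  standard-∈ _ (zigzag-path a 2≤a a≤top pa) with even⇒2+double a pa 2≤a
  ... | b , refl = ∈-++⁺ʳ rungPaths (∈-++⁺ʳ returnPaths (there (∈-++⁺ˡ (∈-applyUpTo⁺ zigzagPathAt (2+b+b≤n⇒b<⌊n/2⌋ b top a≤top)))))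
  standard-∈ _ (spiral-path e) =
    ∈-++⁺ʳ rungPaths (∈-++⁺ʳ returnPaths (there (∈-++⁺ʳ zigzagPaths (subst (λ t → spiralPath ∈ spiralPathsIf t) (sym e) (here refl)))))

  returnPath-injective : ∀ a k a' k' → k < top ∸ a → k' < top ∸ a' → returnPath a k ≡ returnPath a' k' → a ≡ a' × k ≡ k'
  returnPath-injective a k a' k' p q e with applyUpTo-branch-injective rail coRail coRail≢rail a a' (λ j → coRail≢rail a' j) e
  ... | refl , _ , e₃ = refl , corridor-injective leftStrip (top ∸ a) k k' true (leftStrip-injective (top ∸ a) (m∸n≤m top a)) p q
                                 (++-cancelˡ (applyDownFrom coRail a) _ _ e₃)

  rung≢rail-prefix : ∀ k a Y → 1 ≤ a → rungPath k ≢ applyUpTo rail a ++ rail a ∷ Y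
  rung≢rail-prefix k a Y p e with trans e (proj₂ (rail-prefix a Y p))
  ... | ()

  rung≢other : ∀ p → IsRung p → IsReturn p ⊎ IsHairpin p ⊎ IsZigzag p ⊎ IsSpiral p → ⊥
  rung≢other p (k , _ , refl) (inj₁ (a , _ , 1≤a , _ , e)) = rung≢rail-prefix k a _ 1≤a e
  rung≢other p (k , _ , refl) (inj₂ (inj₁ e)) = rung≢rail-prefix k top _ (s≤s z≤n) e
  rung≢other p (k , _ , refl) (inj₂ (inj₂ (inj₁ (a , 2≤a , _ , _ , e)))) = rung≢rail-prefix k a _ (≤-trans (s≤s z≤n) 2≤a) e
  rung≢other p (k , _ , refl) (inj₂ (inj₂ (inj₂ (_ , e)))) = rung≢rail-prefix k top _ (s≤s z≤n) e

  return≢other : ∀ p → IsReturn p → IsHairpin p ⊎ IsZigzag p ⊎ IsSpiral p → ⊥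
  return≢other p (a , k , _ , k<D , refl) (inj₁ e) with applyUpTo-branch-injective rail coRail coRail≢rail a top (λ j → coRail≢rail top j) e
  ... | refl , _ = <-irrefl refl (∸-positive⇒< k<D)
  return≢other p (a , k , 1≤a , k<D , refl) (inj₂ (inj₁ (b , _ , _ , _ , e)))
    with applyUpTo-branch-injective rail coRail coRail≢rail a b (λ j → coRail≢rail b j) e
  ... | refl , _ , e₃ = heads-differ a 1≤a k<D e₃
    where
    heads-differ : ∀ a → 1 ≤ a → k < top ∸ a
      → applyDownFrom coRail a ++ corridor leftStrip (top ∸ a) k true ≡ corridor (rightStrip (suc a)) (top ∸ a) (top ∸ a ∸ 1) (parity a) ++ applyUpTo coRail a
      → ⊥
    heads-differ (suc a′) _ k<D′ e′ with corridor-head (rightStrip (suc (suc a′))) (top ∸ suc (suc a′)) (top ∸ suc a′ ∸ 1) (parity (suc a′))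
    ... | t , starts = <-irrefl (cong proj₁ (proj₁ (∷-injective (trans e′ (cong (_++ applyUpTo coRail (suc a′))
        (trans (cong (λ L → corridor (rightStrip (suc (suc a′))) L (top ∸ suc a′ ∸ 1) (parity (suc a′))) (∸-suc {top} {suc a′} (∸-positive⇒< k<D′))) starts))))))
      (≤-trans (n<1+n a′) (n≤1+n (suc a′)))
  return≢other p (a , k , _ , k<D , refl) (inj₂ (inj₂ (_ , e))) with applyUpTo-branch-injective rail coRail coRail≢rail a top (λ j → coRail≢rail 0 j) e
  ... | refl , _ = <-irrefl refl (∸-positive⇒< k<D)

  hairpin≢other : ∀ p → IsHairpin p → IsZigzag p ⊎ IsSpiral p → ⊥
  hairpin≢other p refl (inj₁ (b , _ , _ , _ , e)) with applyUpTo-branch-injective rail coRail coRail≢rail top b (λ j → coRail≢rail b j) e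
  ... | refl , _ , e₃ = 1+n≢0 (cong proj₁ (proj₁ (∷-injective (trans e₃
    (cong (λ L → corridor (rightStrip (suc top)) L (L ∸ 1) (parity top) ++ applyUpTo coRail top) (n∸n≡0 top))))))
  hairpin≢other p refl (inj₂ (_ , e)) with applyUpTo-branch-injective rail coRail coRail≢rail top top (λ j → coRail≢rail 0 j) e
  ... | _ , e₂ , _ = 1+n≢0 (cong proj₁ e₂)

  zigzag≢spiral : ∀ p → IsZigzag p → IsSpiral p → ⊥
  zigzag≢spiral p (b , _ , _ , _ , refl) (_ , e) with applyUpTo-branch-injective rail coRail coRail≢rail b top (λ j → coRail≢rail 0 j) e
  ... | refl , e₂ , _ = 1+n≢0 (cong proj₁ e₂)

  rungPaths-unique : Unique rungPaths
  rungPaths-unique = Unique.applyUpTo⁺₁ rungPath top (λ {i} {j} i<j j<top e → <-irrefl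
    (corridor-injective (rightStrip 1) top i j false (rightStrip-injective 1 top) (<-trans i<j j<top) j<top (proj₂ (∷-injective (proj₂ (∷-injective e))))) i<j)

  returnPaths-unique : Unique returnPaths
  returnPaths-unique = Unique.concat⁺ (Allₚ.applyUpTo⁺₁ returnPathsAt (suc m) (λ {a′} _ → unique-at a′))
                                      (AllPairsₚ.applyUpTo⁺₁ returnPathsAt (suc m) (λ {i} {j} i<j _ → disjoint-at i j i<j))
    where
    unique-at : ∀ a′ → Unique (returnPathsAt a′)
    unique-at a′ = Unique.applyUpTo⁺₁ (returnPath (suc a′)) _
      (λ {k} {k'} k<k' k'<D e → <-irrefl (proj₂ (returnPath-injective (suc a′) k (suc a′) k' (<-trans k<k' k'<D) k'<D e)) k<k')
    disjoint-at : ∀ i j → i < j → Disjoint (returnPathsAt i) (returnPathsAt j)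
    disjoint-at i j i<j = disjoint-by (λ v m′ → ∈-applyUpTo⁻ (returnPath (suc i)) m′) (λ v m′ → ∈-applyUpTo⁻ (returnPath (suc j)) m′)
      (λ v (k , q , e₁) (k' , q' , e₂) → <-irrefl (suc-injective (proj₁ (returnPath-injective _ _ _ _ q q' (trans (sym e₁) e₂)))) i<j)

  zigzagPaths-unique : Unique zigzagPaths
  zigzagPaths-unique = Unique.applyUpTo⁺₁ zigzagPathAt ⌊ top /2⌋ (λ {b} {b'} b<b' _ e → <-irrefl
    (double-injective b b' (suc-injective (suc-injective (proj₁ (applyUpTo-branch-injective rail coRail coRail≢rail _ _ (λ j → coRail≢rail _ j) e))))) b<b')

  spiralPaths-unique : Unique spiralPaths
  spiralPaths-unique = unique-if (parity h)
    where
    unique-if : ∀ b → Unique (spiralPathsIf b)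
    unique-if true = []
    unique-if false = [] ∷ []

  rightwardPaths-unique : Unique rightwardPaths
  rightwardPaths-unique =
    unique-++ rungPaths-unique
      (unique-++ returnPaths-unique
         (All.tabulate (λ {v} → hairpin≢later v) ∷ unique-++ zigzagPaths-unique spiralPaths-unique ∈-zigzagPaths⁻ ∈-spiralPaths⁻ zigzag≢spiral)
         ∈-returnPaths⁻ ∈-from-hairpin⁻ return≢other)
      ∈-rungPaths⁻ (λ v m′ → ∈-++-by returnPaths ∈-returnPaths⁻ ∈-from-hairpin⁻ v m′) rung≢other
    where
    hairpin≢later : ∀ v → v ∈ zigzagPaths ++ spiralPaths → hairpinPath ≢ v
    hairpin≢later v m′ e = hairpin≢other v (sym e) (∈-++-by zigzagPaths ∈-zigzagPaths⁻ ∈-spiralPaths⁻ v m′)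
    ∈-from-hairpin⁻ : ∀ v → v ∈ hairpinPath ∷ zigzagPaths ++ spiralPaths → IsHairpin v ⊎ IsZigzag v ⊎ IsSpiral v
    ∈-from-hairpin⁻ v (here e) = inj₁ e
    ∈-from-hairpin⁻ v (there m′) = inj₂ (∈-++-by zigzagPaths ∈-zigzagPaths⁻ ∈-spiralPaths⁻ v m′)

  length-rightwardPaths : length rightwardPaths ≡ top + (triangle (suc m) + suc (⌊ top /2⌋ + length spiralPaths))
  length-rightwardPaths = trans (length-++ rungPaths) (cong₂ _+_ (length-applyUpTo rungPath top) (trans (length-++ returnPaths)
    (cong₂ _+_ (trans (length-concat-applyUpTo returnPathsAt (λ i → suc m ∸ i) (suc m) (λ i → length-applyUpTo _ _)) (sumUpTo-triangle (suc m)))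
               (cong suc (trans (length-++ zigzagPaths) (cong (_+ length spiralPaths) (length-applyUpTo zigzagPathAt ⌊ top /2⌋)))))))

  hamiltonianPaths : List (List Node)
  hamiltonianPaths = rightwardPaths ++ map (map σ) rightwardPaths

  rightwardPaths-good : ∀ p → p ∈ rightwardPaths → GoodPath p
  rightwardPaths-good p m′ = standard-good p (∈-rightwardPaths⁻ p m′)

  rightwardPaths-rightward : ∀ p → p ∈ rightwardPaths → Rightward p
  rightwardPaths-rightward p m′ = standard-rightward p (∈-rightwardPaths⁻ p m′)

  σ-rightward-distinct : ∀ p q → Rightward p → Rightward q → map σ q ≢ p
  σ-rightward-distinct _ _ (inj₁ (_ , refl)) (inj₁ (_ , refl)) ()
  σ-rightward-distinct _ _ (inj₁ (_ , refl)) (inj₂ (_ , refl)) ()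
  σ-rightward-distinct _ _ (inj₂ (_ , refl)) (inj₁ (_ , refl)) ()
  σ-rightward-distinct _ _ (inj₂ (_ , refl)) (inj₂ (_ , refl)) ()

  map-map-σ-involutive : ∀ ps → (∀ p → p ∈ ps → ∀ v → v ∈ p → Valid v) → map (map σ) (map (map σ) ps) ≡ ps
  map-map-σ-involutive [] _ = refl
  map-map-σ-involutive (p ∷ ps) valid =
    cong₂ _∷_ (map-σ-involutive p (valid p (here refl))) (map-map-σ-involutive ps (λ q m′ → valid q (there m′)))

  hamiltonianPaths-unique : Unique hamiltonianPaths
  hamiltonianPaths-unique = unique-++ rightwardPaths-unique
    (Unique.map⁻ (subst Unique (sym (map-map-σ-involutive rightwardPaths (λ p m′ → proj₁ (proj₂ (proj₂ (rightwardPaths-good p m′))))))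
                         rightwardPaths-unique))
    rightwardPaths-rightward (λ p m′ → ∈-map⁻ (map σ) m′)
    (λ p p-rightward (q , q∈ , e) → σ-rightward-distinct p q p-rightward (rightwardPaths-rightward q q∈) (sym e))

  hamiltonianPaths-complete : ∀ rest → Hamiltonian ((0 , false) ∷ rest) → (0 , false) ∷ rest ∈ hamiltonianPaths
  hamiltonianPaths-complete rest ham with rightward-or-σ rest ham
  ... | inj₁ rw = ∈-++⁺ˡ (standard-∈ _ (rightward-standard _ ham rw))
  ... | inj₂ rw = ∈-++⁺ʳ rightwardPaths (subst (_∈ map (map σ) rightwardPaths) (map-σ-involutive _ (proj₁ (proj₂ (proj₂ ham))))
                      (∈-map⁺ (map σ) (standard-∈ _ (rightward-standard _ (σ-hamiltonian _ ham) rw))))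

  rightward-head : ∀ {p} → Rightward p → ∃ λ t → p ≡ (0 , false) ∷ t
  rightward-head (inj₁ (_ , refl)) = _ , refl
  rightward-head (inj₂ (_ , refl)) = _ , refl

  hamiltonianPaths-sound : ∀ p → p ∈ hamiltonianPaths → GoodPath p × ∃ λ t → p ≡ (0 , false) ∷ t
  hamiltonianPaths-sound p m′ with ∈-++⁻ rightwardPaths m′
  ... | inj₁ m″ = rightwardPaths-good p m″ , rightward-head (rightwardPaths-rightward p m″)
  ... | inj₂ m″ with ∈-map⁻ (map σ) m″
  ...   | q , q∈ , refl with rightwardPaths-rightward q q∈
  ...     | inj₁ (_ , refl) = σ-good q (rightwardPaths-good q q∈) , _ , refl
  ...     | inj₂ (_ , refl) = σ-good q (rightwardPaths-good q q∈) , _ , refl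

  length-hamiltonianPaths : length hamiltonianPaths ≡ 2 * top + suc m * top + 2 + 2 * ⌊ top /2⌋ + 2 * length spiralPaths
  length-hamiltonianPaths = begin
    length hamiltonianPaths
      ≡⟨ trans (length-++ rightwardPaths) (cong (length rightwardPaths +_) (length-map (map σ) rightwardPaths)) ⟩
    length rightwardPaths + length rightwardPaths
      ≡⟨ cong₂ _+_ length-rightwardPaths length-rightwardPaths ⟩
    R + R
      ≡⟨ double (triangle (suc m)) ⟩
    2 * top + (triangle (suc m) + triangle (suc m)) + 2 + 2 * ⌊ top /2⌋ + 2 * length spiralPaths
      ≡⟨ cong (λ t → 2 * top + t + 2 + 2 * ⌊ top /2⌋ + 2 * length spiralPaths) (triangle-double (suc m)) ⟩
    2 * top + suc m * top + 2 + 2 * ⌊ top /2⌋ + 2 * length spiralPaths ∎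
    where
    open ≡-Reasoning
    R : ℕ
    R = top + (triangle (suc m) + suc (⌊ top /2⌋ + length spiralPaths))
    double : ∀ T → (top + (T + suc (⌊ top /2⌋ + length spiralPaths))) + (top + (T + suc (⌊ top /2⌋ + length spiralPaths)))
                 ≡ 2 * top + (T + T) + 2 + 2 * ⌊ top /2⌋ + 2 * length spiralPaths
    double T = rearrange top T ⌊ top /2⌋ (length spiralPaths)
      where
      rearrange : ∀ a T f s → (a + (T + suc (f + s))) + (a + (T + suc (f + s))) ≡ 2 * a + (T + T) + 2 + 2 * f + 2 * s
      rearrange = solve-∀

module Circulant (m : ℕ) where

  open import Data.Nat using (ℕ; zero; suc; _+_; _∸_; _<_; _≤_; _⊓_; z≤n; s≤s; _≤?_; _%_)
  open import Data.Nat.Properties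
  open import Data.Nat.DivMod using (m<n⇒m%n≡m; [m+n]%n≡m%n; n%n≡0)
  open import Data.Bool using (true; false)
  open import Data.Product using (_×_; _,_)
  open import Data.Sum using (_⊎_; inj₁; inj₂)
  open import Data.Empty using (⊥-elim)
  open import Relation.Nullary using (yes; no)
  open import Relation.Binary.PropositionalEquality
  open import Relation.Binary.Definitions using (tri<; tri≈; tri>)
  open Ladder m

  n : ℕ
  n = h + h

  label : Node → ℕ
  label (c , false) = suc c
  label (c , true) = suc (h + c)

  dist-+ : ∀ a d → 0 < d → d < n → dist n a (a + d) ≡ (n ∸ d) ⊓ d
  dist-+ a d 0<d d<n = cong₂ _⊓_ down up
    where
    down : (a + n ∸ (a + d)) % n ≡ n ∸ d
    down = trans (cong (_% n) ([m+n]∸[m+o]≡n∸o a n d)) (m<n⇒m%n≡m (∸-monoʳ-< {m = n} {n = d} {o = 0} 0<d (<⇒≤ d<n)))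
    up : (a + d + n ∸ a) % n ≡ d
    up = trans (cong (_% n) (trans (cong (_∸ a) (+-assoc a d n)) (m+n∸m≡n a (d + n)))) (trans ([m+n]%n≡m%n d n) (m<n⇒m%n≡m d<n))

  dist-sym : ∀ a b → dist n a b ≡ dist n b a
  dist-sym a b = ⊓-comm _ _

  dist-self : ∀ a → dist n a a ≡ 0
  dist-self a = trans (cong (λ t → (t % n) ⊓ (t % n)) (m+n∸m≡n a n)) (cong (λ t → t ⊓ t) (n%n≡0 n))

  n≡top+1+h : n ≡ top + suc h
  n≡top+1+h = sym (+-suc top h)

  top≤h : top ≤ h
  top≤h = n≤1+n top

  top≤1+h : top ≤ suc h
  top≤1+h = m≤n⇒m≤1+n top≤h

  offset-far : ∀ d → top ≤ d → d ≤ suc h → top ≤ (n ∸ d) ⊓ d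
  offset-far d top≤d d≤1+h = ⊓-glb (subst (top ≤_) (sym (cong (_∸ d) n≡top+1+h))
    (subst (_≤ top + suc h ∸ d) (m+n∸n≡m top (suc h)) (∸-monoʳ-≤ (top + suc h) d≤1+h))) top≤d

  far-above : ∀ x y d → y ≡ x + d → top ≤ d → d ≤ suc h → top ≤ dist n x y
  far-above x _ d refl top≤d d≤1+h = subst (top ≤_) (sym (dist-+ x d (≤-trans (s≤s z≤n) top≤d) d<n)) (offset-far d top≤d d≤1+h)
    where
    d<n : d < n
    d<n = ≤-trans (s≤s d≤1+h) (subst (suc (suc h) ≤_) (sym n≡top+1+h) (+-monoˡ-≤ (suc h) {1} {top} (s≤s z≤n)))

  far-below : ∀ x y d → x ≡ y + d → top ≤ d → d ≤ suc h → top ≤ dist n x y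
  far-below x y d e top≤d d≤1+h = subst (top ≤_) (dist-sym y x) (far-above y x d e top≤d d≤1+h)

  h+1+c≡1+c+h : ∀ c → suc (h + suc c) ≡ suc c + suc h
  h+1+c≡1+c+h c = cong suc (trans (+-suc h c) (trans (cong suc (+-comm h c)) (sym (+-suc c h))))

  h+c≡2+c+top : ∀ c → suc (h + c) ≡ suc (suc c) + top
  h+c≡2+c+top c = cong (λ t → suc (suc t)) (+-comm top c)


  adj⇒far : ∀ u v → Adj u v → top ≤ dist n (label u) (label v)
  adj⇒far _ _ (rung c false) = far-above (suc c) (suc (h + c)) h (cong suc (+-comm h c)) top≤h (n≤1+n h)
  adj⇒far _ _ (rung c true) = far-below (suc (h + c)) (suc c) h (cong suc (+-comm h c)) top≤h (n≤1+n h)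
  adj⇒far _ _ (right c false p) = far-above (suc c) (suc (h + suc c)) (suc h) (h+1+c≡1+c+h c) top≤1+h ≤-refl
  adj⇒far _ _ (right c true p) = far-below (suc (h + c)) (suc (suc c)) top (h+c≡2+c+top c) ≤-refl top≤1+h
  adj⇒far _ _ (left c false p) = far-above (suc (suc c)) (suc (h + c)) top (h+c≡2+c+top c) ≤-refl top≤1+h
  adj⇒far _ _ (left c true p) = far-below (suc (h + suc c)) (suc c) (suc h) (h+1+c≡1+c+h c) top≤1+h ≤-refl
  adj⇒far _ _ (wrapR false) = far-below h 1 top refl ≤-refl top≤1+h
  adj⇒far _ _ (wrapR true) = far-below (suc (h + top)) (suc (h + 0)) top (cong suc (cong (_+ top) (sym (+-identityʳ h)))) ≤-refl top≤1+h
  adj⇒far _ _ (wrapL false) = far-above 1 h top refl ≤-refl top≤1+h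
  adj⇒far _ _ (wrapL true) = far-above (suc (h + 0)) (suc (h + top)) top (cong suc (cong (_+ top) (sym (+-identityʳ h)))) ≤-refl top≤1+h

  FarOffset : ℕ → Set
  FarOffset d = d ≡ top ⊎ d ≡ h ⊎ d ≡ suc h

  far⇒far-offset : ∀ d → top ≤ (n ∸ d) ⊓ d → FarOffset d
  far⇒far-offset d far = offset (d ∸ top) (sym (m+[n∸m]≡n top≤d)) excess≤2
    where
    top≤d : top ≤ d
    top≤d = ≤-trans far (m⊓n≤n (n ∸ d) d)
    top≤n∸d : top ≤ n ∸ d
    top≤n∸d = ≤-trans far (m⊓n≤m (n ∸ d) d)
    d<n : d < n
    d<n = m∸n≢0⇒n<m (λ e → <⇒≱ (s≤s z≤n) (subst (top ≤_) e top≤n∸d))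
    d≤1+h : d ≤ suc h
    d≤1+h = +-cancelˡ-≤ top d (suc h) (subst (top + d ≤_) n≡top+1+h (subst (top + d ≤_) (m∸n+n≡m (<⇒≤ d<n)) (+-monoˡ-≤ d top≤n∸d)))
    excess≤2 : d ∸ top ≤ 2
    excess≤2 = +-cancelˡ-≤ top (d ∸ top) 2 (subst₂ _≤_ (sym (m+[n∸m]≡n top≤d)) (+-comm 2 top) d≤1+h)
    offset : ∀ e → d ≡ top + e → e ≤ 2 → FarOffset d
    offset zero eq _ = inj₁ (trans eq (+-identityʳ top))
    offset (suc zero) eq _ = inj₂ (inj₁ (trans eq (+-comm top 1)))
    offset (suc (suc zero)) eq _ = inj₂ (inj₂ (trans eq (+-comm top 2)))
    offset (suc (suc (suc e))) eq (s≤s (s≤s ()))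

  far-offset-same-side : ∀ c c' d → c' < h → FarOffset d → c' ≡ c + d → c ≡ 0 × c' ≡ top
  far-offset-same-side zero c' d q (inj₁ refl) e = refl , e
  far-offset-same-side (suc c) c' d q (inj₁ refl) e = ⊥-elim (<⇒≱ q (subst (h ≤_) (sym e) (s≤s (m≤n+m top c))))
  far-offset-same-side c c' d q (inj₂ (inj₁ refl)) e = ⊥-elim (<⇒≱ q (subst (h ≤_) (sym e) (m≤n+m h c)))
  far-offset-same-side c c' d q (inj₂ (inj₂ refl)) e = ⊥-elim (<⇒≱ q (subst (h ≤_) (sym e) (≤-trans (n≤1+n h) (m≤n+m (suc h) c))))

  far-offset⇒adj : ∀ u v d → Valid u → Valid v → FarOffset d → label v ≡ label u + d → Adj u v
  far-offset⇒adj (c , false) (c' , false) d pu pv far e with far-offset-same-side c c' d pv far (suc-injective e)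
  ... | refl , refl = wrapL false
  far-offset⇒adj (c , true) (c' , true) d pu pv far e
    with far-offset-same-side c c' d pv far (+-cancelˡ-≡ h c' (c + d) (trans (suc-injective e) (+-assoc h c d)))
  ... | refl , refl = wrapL true
  far-offset⇒adj (c , true) (c' , false) d pu pv far e =
    ⊥-elim (<⇒≱ pv (subst (h ≤_) (sym (suc-injective e)) (≤-trans (m≤m+n h c) (m≤m+n (h + c) d))))
  far-offset⇒adj (c , false) (c' , true) d pu pv (inj₁ refl) e
    with +-cancelʳ-≡ top c (suc c') (trans (sym (suc-injective e)) (cong suc (+-comm top c')))
  ... | refl = left c' false pu
  far-offset⇒adj (c , false) (c' , true) d pu pv (inj₂ (inj₁ refl)) e with +-cancelʳ-≡ h c' c (trans (+-comm c' h) (suc-injective e))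
  ... | refl = rung c false
  far-offset⇒adj (c , false) (c' , true) d pu pv (inj₂ (inj₂ refl)) e
    with +-cancelʳ-≡ h c' (suc c) (trans (+-comm c' h) (trans (suc-injective e) (+-suc c h)))
  ... | refl = right c false pv

  label≤n : ∀ v → Valid v → label v ≤ n
  label≤n (c , false) p = ≤-trans p (m≤m+n h h)
  label≤n (c , true) p = +-monoʳ-< h p

  label-positive : ∀ v → 0 < label v
  label-positive (_ , false) = s≤s z≤n
  label-positive (_ , true) = s≤s z≤n

  far⇒adj-< : ∀ u v → Valid u → Valid v → label u < label v → top ≤ dist n (label u) (label v) → Adj u v
  far⇒adj-< u v pu pv lt far = far-offset⇒adj u v d pu pv (far⇒far-offset d far′) label-v≡
    where
    d : ℕ
    d = label v ∸ label u
    label-v≡ : label v ≡ label u + d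
    label-v≡ = sym (m+[n∸m]≡n (<⇒≤ lt))
    d<n : d < n
    d<n = <-≤-trans (∸-monoʳ-< {m = label v} {n = label u} {o = 0} (label-positive u) (<⇒≤ lt)) (label≤n v pv)
    far′ : top ≤ (n ∸ d) ⊓ d
    far′ = subst (top ≤_) (trans (cong (dist n (label u)) label-v≡) (dist-+ (label u) d (m<n⇒0<n∸m lt) d<n)) far

  far⇒adj : ∀ u v → Valid u → Valid v → top ≤ dist n (label u) (label v) → Adj u v
  far⇒adj u v pu pv far with <-cmp (label u) (label v)
  ... | tri< lt _ _ = far⇒adj-< u v pu pv lt far
  ... | tri> _ _ gt = Adj-sym v u (far⇒adj-< v u pv pu gt (subst (top ≤_) (dist-sym (label u) (label v)) far))
  ... | tri≈ _ e _ = ⊥-elim (<⇒≱ (s≤s z≤n) (subst (top ≤_) (trans (cong (dist n (label u)) (sym e)) (dist-self (label u))) far))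

  node : ℕ → Node
  node x with x ≤? h
  ... | yes _ = (x ∸ 1 , false)
  ... | no _ = (x ∸ 1 ∸ h , true)

  label-node : ∀ x → 1 ≤ x → label (node x) ≡ x
  label-node (suc x) _ with suc x ≤? h
  ... | yes _ = refl
  ... | no x≰h = cong suc (m+[n∸m]≡n (≤-pred (≰⇒> x≰h)))

  node-valid : ∀ x → 1 ≤ x → x ≤ n → Valid (node x)
  node-valid (suc x) _ x≤n with suc x ≤? h
  ... | yes x≤h = x≤h
  ... | no x≰h = subst (x ∸ h <_) (m+n∸n≡m h h) (∸-monoˡ-< x≤n (≤-pred (≰⇒> x≰h)))

  node-label : ∀ v → Valid v → node (label v) ≡ v
  node-label (c , false) p with suc c ≤? h
  ... | yes _ = refl
  ... | no c≰h = ⊥-elim (c≰h p)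
  node-label (c , true) p with suc (h + c) ≤? h
  ... | yes q = ⊥-elim (<⇒≱ (s≤s (m≤m+n h c)) q)
  ... | no _ = cong (_, true) (m+n∸m≡n h c)

  label-range : ∀ v → Valid v → 1 ≤ label v × label v ≤ n
  label-range v p = label-positive v , label≤n v p

module Permutations where

  open import Data.Nat using (suc; _≤_; z≤n; s≤s)
  open import Data.Nat.Properties using (+-suc; ≤-trans; 1+n≰n)
  open import Data.List using (List; []; _∷_; _++_; length)
  open import Data.List.Properties using (length-++)
  open import Data.List.Membership.Propositional using (_∈_)
  open import Data.List.Membership.Propositional.Properties using (∈-++⁺ˡ; ∈-++⁺ʳ; ∈-++⁻; ∈-∃++)
  open import Data.List.Membership.Propositional.Properties.WithK using (unique∧set⇒bag)
  import Data.List.Membership.DecPropositional as DecMembership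
  open import Data.List.Relation.Unary.Any using (here; there)
  import Data.List.Relation.Unary.All as All
  open import Data.List.Relation.Unary.AllPairs using (_∷_)
  open import Data.List.Relation.Unary.Unique.Propositional using (Unique)
  open import Data.List.Relation.Binary.Permutation.Propositional using (_↭_)
  open import Data.List.Relation.Binary.BagAndSetEquality using (∼bag⇒↭)
  open import Data.Product using (_,_)
  open import Data.Sum using (inj₁; inj₂)
  open import Data.Empty using (⊥-elim)
  open import Function.Bundles using (mk⇔)
  open import Relation.Nullary using (yes; no)
  open import Relation.Binary.Definitions using (DecidableEquality)
  open import Relation.Binary.PropositionalEquality

  private variable
    A : Set

  unique-same-members⇒↭ : ∀ {xs ys : List A} → Unique xs → Unique ys → (∀ x → x ∈ xs → x ∈ ys) → (∀ x → x ∈ ys → x ∈ xs) → xs ↭ ys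
  unique-same-members⇒↭ ux uy f g = ∼bag⇒↭ (unique∧set⇒bag ux uy (λ {x} → mk⇔ (f x) (g x)))

  unique-⊆⇒length≤ : (xs ys : List A) → Unique xs → (∀ x → x ∈ xs → x ∈ ys) → length xs ≤ length ys
  unique-⊆⇒length≤ [] ys u f = z≤n
  unique-⊆⇒length≤ (x ∷ xs) ys (x∉ ∷ u) f with ∈-∃++ (f x (here refl))
  ... | ys₁ , ys₂ , refl = subst (suc (length xs) ≤_) (sym (trans (length-++ ys₁) (+-suc (length ys₁) (length ys₂))))
    (s≤s (subst (length xs ≤_) (length-++ ys₁) (unique-⊆⇒length≤ xs (ys₁ ++ ys₂) u f′)))
    where
    f′ : ∀ y → y ∈ xs → y ∈ ys₁ ++ ys₂
    f′ y m with ∈-++⁻ ys₁ (f y (there m))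
    ... | inj₁ m′ = ∈-++⁺ˡ m′
    ... | inj₂ (here e) = ⊥-elim (All.lookup x∉ m (sym e))
    ... | inj₂ (there m′) = ∈-++⁺ʳ ys₁ m′

  unique-⊆-length≥⇒⊇ : DecidableEquality A → (xs ys : List A) → Unique xs → (∀ x → x ∈ xs → x ∈ ys) → length ys ≤ length xs
    → ∀ y → y ∈ ys → y ∈ xs
  unique-⊆-length≥⇒⊇ _≟_ xs ys u f le y m with DecMembership._∈?_ _≟_ y xs
  ... | yes y∈ = y∈
  ... | no y∉ = ⊥-elim (1+n≰n (≤-trans (unique-⊆⇒length≤ (y ∷ xs) ys (All.tabulate (λ {z} z∈ e → y∉ (subst (_∈ xs) (sym e) z∈)) ∷ u) f′) le))
    where
    f′ : ∀ x → x ∈ y ∷ xs → x ∈ ys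
    f′ x (here refl) = m
    f′ x (there m′) = f x m′


module Rows (m : ℕ) where

  open import Data.Nat using (ℕ; suc; _+_; _∸_; _≤_; z≤n; s≤s; _/_)
  open import Data.Nat.Properties using (_≟_; suc-injective; +-identityʳ; *-comm; ≤-reflexive)
  open import Data.Nat.DivMod using (m*n/n≡m)
  open import Data.Bool using (false)
  open import Data.List using (List; []; _∷_; map; length; upTo)
  open import Data.List.Properties using (length-map; length-upTo)
  open import Data.List.Membership.Propositional using (_∈_)
  open import Data.List.Membership.Propositional.Properties using (∈-map⁻; ∈-map⁺; ∈-upTo⁻; ∈-upTo⁺)
  open import Data.List.Relation.Unary.Any using (here; there)
  open import Data.List.Relation.Unary.Linked using (Linked; []; [-]; _∷_)
  open import Data.List.Relation.Unary.Unique.Propositional using (Unique)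
  import Data.List.Relation.Unary.Unique.Propositional.Properties as Unique
  open import Data.List.Relation.Binary.Permutation.Propositional using (↭-sym; ↭⇒↭ₛ)
  open import Data.List.Relation.Binary.Permutation.Propositional.Properties using (∈-resp-↭)
  import Data.List.Relation.Binary.Permutation.Setoid.Properties as Permutation
  open import Data.Product using (_×_; _,_; proj₁; proj₂)
  open import Relation.Binary.PropositionalEquality
  open Permutations
  open Ladder m
  open Circulant m

  n/2≡h : n / 2 ≡ h
  n/2≡h = trans (cong (_/ 2) (trans (cong (h +_) (sym (+-identityʳ h))) (*-comm 2 h))) (m*n/n≡m h 2)

  Far : ℕ → ℕ → Set
  Far a b = top ≤ dist n a b

  InRange : ℕ → Set
  InRange x = 1 ≤ x × x ≤ n

  ∈-[1,n]⁻ : ∀ x → x ∈ [1, n ] → InRange x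
  ∈-[1,n]⁻ x x∈ with ∈-map⁻ suc x∈
  ... | y , y∈ , refl = s≤s z≤n , ∈-upTo⁻ y∈

  ∈-[1,n]⁺ : ∀ x → InRange x → x ∈ [1, n ]
  ∈-[1,n]⁺ (suc y) (_ , y<n) = ∈-map⁺ suc (∈-upTo⁺ y<n)

  [1,n]-unique : Unique [1, n ]
  [1,n]-unique = Unique.map⁺ suc-injective (Unique.upTo⁺ n)

  length-[1,n] : length [1, n ] ≡ n
  length-[1,n] = trans (length-map suc (upTo n)) (length-upTo n)

  map-node-label : ∀ p → (∀ v → v ∈ p → Valid v) → map node (map label p) ≡ p
  map-node-label [] _ = refl
  map-node-label (v ∷ p) valid = cong₂ _∷_ (node-label v (valid v (here refl))) (map-node-label p (λ w w∈ → valid w (there w∈)))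

  map-label-node : ∀ s → (∀ x → x ∈ s → InRange x) → map label (map node s) ≡ s
  map-label-node [] _ = refl
  map-label-node (x ∷ s) range = cong₂ _∷_ (label-node x (proj₁ (range x (here refl)))) (map-label-node s (λ y y∈ → range y (there y∈)))

  label-linked : ∀ p → Linked Adj p → Linked Far (map label p)
  label-linked [] _ = []
  label-linked (x ∷ []) _ = [-]
  label-linked (x ∷ y ∷ p) (a ∷ l) = adj⇒far x y a ∷ label-linked (y ∷ p) l

  node-linked : ∀ s → (∀ x → x ∈ s → InRange x) → Linked Far s → Linked Adj (map node s)
  node-linked [] _ _ = []
  node-linked (x ∷ []) _ _ = [-]
  node-linked (x ∷ y ∷ s) range (far ∷ l) =
    far⇒adj (node x) (node y) (node-valid x (proj₁ x-range) (proj₂ x-range)) (node-valid y (proj₁ y-range) (proj₂ y-range))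
      (subst₂ Far (sym (label-node x (proj₁ x-range))) (sym (label-node y (proj₁ y-range))) far)
    ∷ node-linked (y ∷ s) (λ z z∈ → range z (there z∈)) l
    where
    x-range = range x (here refl)
    y-range = range y (there (here refl))

  goodRows : List (List ℕ)
  goodRows = map (map label) hamiltonianPaths

  goodRows-sound : ∀ s → s ∈ goodRows → GoodRow n s
  goodRows-sound s s∈ with ∈-map⁻ (map label) s∈
  ... | p , p∈ , refl with hamiltonianPaths-sound p p∈
  ...   | (lk , u , valid , len) , (t , refl) = latin , refl , subst (λ t → Linked (λ a b → t ∸ 1 ≤ dist n a b) (map label p)) (sym n/2≡h) (label-linked p lk)
    where
    labels-unique : Unique (map label p)
    labels-unique = Unique.map⁻ (subst Unique (sym (map-node-label p valid)) u)
    labels⊆ : ∀ x → x ∈ map label p → x ∈ [1, n ]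
    labels⊆ x x∈ with ∈-map⁻ label x∈
    ... | v , v∈ , refl = ∈-[1,n]⁺ _ (label-range v (valid v v∈))
    latin : LatinRow n (map label p)
    latin = unique-same-members⇒↭ labels-unique [1,n]-unique labels⊆
      (unique-⊆-length≥⇒⊇ _≟_ (map label p) [1, n ] labels-unique labels⊆ (≤-reflexive (trans length-[1,n] (sym (trans (length-map label p) len)))))

  goodRows-complete : ∀ s → GoodRow n s → s ∈ goodRows
  goodRows-complete (_ ∷ rest) (latin , refl , maxDist) =
    subst (_∈ goodRows) (map-label-node (1 ∷ rest) range) (∈-map⁺ (map label) (subst (_∈ hamiltonianPaths) (cong (_∷ map node rest) (sym node-1))
      (hamiltonianPaths-complete (map node rest) (subst Hamiltonian (cong (_∷ map node rest) node-1) (lk , u , valid , cov)))))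
    where
    s : List ℕ
    s = 1 ∷ rest
    range : ∀ x → x ∈ s → InRange x
    range x x∈ = ∈-[1,n]⁻ x (∈-resp-↭ latin x∈)
    node-1 : node 1 ≡ (0 , false)
    node-1 = node-label (0 , false) (s≤s z≤n)
    lk : Linked Adj (map node s)
    lk = node-linked s range (subst (λ t → Linked (λ a b → t ∸ 1 ≤ dist n a b) s) n/2≡h maxDist)
    u : Unique (map node s)
    u = Unique.map⁻ (subst Unique (sym (map-label-node s range)) (Permutation.Unique-resp-↭ (setoid ℕ) (↭⇒↭ₛ (↭-sym latin)) [1,n]-unique))
    valid : ∀ v → v ∈ map node s → Valid v
    valid v v∈ with ∈-map⁻ node v∈
    ... | x , x∈ , refl = node-valid x (proj₁ (range x x∈)) (proj₂ (range x x∈))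
    cov : ∀ v → Valid v → v ∈ map node s
    cov v pv = subst (_∈ map node s) (node-label v pv) (∈-map⁺ node (∈-resp-↭ (↭-sym latin) (∈-[1,n]⁺ (label v) (label-range v pv))))

  map-map-node-label : ∀ ps → (∀ p → p ∈ ps → ∀ v → v ∈ p → Valid v) → map (map node) (map (map label) ps) ≡ ps
  map-map-node-label [] _ = refl
  map-map-node-label (p ∷ ps) valid = cong₂ _∷_ (map-node-label p (valid p (here refl))) (map-map-node-label ps (λ q q∈ → valid q (there q∈)))

  count-goodRows : CountIs n (length hamiltonianPaths)
  count-goodRows = goodRows , goodRows-unique , goodRows-sound , goodRows-complete , length-map (map label) hamiltonianPaths
    where
    goodRows-unique : Unique goodRows
    goodRows-unique = Unique.map⁻ (subst Unique
      (sym (map-map-node-label hamiltonianPaths (λ p p∈ → proj₁ (proj₂ (proj₂ (proj₁ (hamiltonianPaths-sound p p∈)))))))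
      hamiltonianPaths-unique)

module Counting where

  open import Data.Nat using (ℕ; zero; suc; _+_; _*_; ⌊_/2⌋)
  open import Data.Nat.Properties using (n≡⌊n+n/2⌋)
  open import Data.Bool using (not)
  open import Data.Bool.Properties using (not-involutive)
  open import Data.List using (length)
  open import Data.Nat.Tactic.RingSolver using (solve-∀)
  open import Relation.Binary.PropositionalEquality
  open Arithmetic

  count-h-even : ∀ j → length (Ladder.hamiltonianPaths (suc (j + j))) ≡ 4 * (2 + j) * (2 + j) + 2
  count-h-even j = trans (Ladder.length-hamiltonianPaths m)
    (trans (cong₂ (λ f s → 2 * (3 + (j + j)) + (2 + (j + j)) * (3 + (j + j)) + 2 + 2 * f + 2 * s) half spiral) (polynomial j))
    where
    m : ℕ
    m = suc (j + j)
    half : ⌊ 3 + (j + j) /2⌋ ≡ suc j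
    half = cong suc (⌊1+n+n/2⌋≡n j)
    spiral : length (Ladder.spiralPaths m) ≡ 1
    spiral = cong (λ b → length (Ladder.spiralPathsIf m b))
      (trans (not-involutive _) (trans (not-involutive (parity (j + j))) (parity-double j)))
    polynomial : ∀ j → 2 * (3 + (j + j)) + (2 + (j + j)) * (3 + (j + j)) + 2 + 2 * suc j + 2 * 1 ≡ 4 * (2 + j) * (2 + j) + 2
    polynomial = solve-∀

  count-h-odd : ∀ j → length (Ladder.hamiltonianPaths (j + j)) ≡ 4 * suc j * suc j + 4 * suc j + 2
  count-h-odd j = trans (Ladder.length-hamiltonianPaths (j + j))
    (trans (cong₂ (λ f s → 2 * (2 + (j + j)) + (1 + (j + j)) * (2 + (j + j)) + 2 + 2 * f + 2 * s) half spiral) (polynomial j))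
    where
    half : ⌊ 2 + (j + j) /2⌋ ≡ suc j
    half = cong suc (sym (n≡⌊n+n/2⌋ j))
    spiral : length (Ladder.spiralPaths (j + j)) ≡ 0
    spiral = cong (λ b → length (Ladder.spiralPathsIf (j + j) b)) (trans (not-involutive _) (cong not (parity-double j)))
    polynomial : ∀ j → 2 * (2 + (j + j)) + (1 + (j + j)) * (2 + (j + j)) + 2 + 2 * suc j + 2 * 0 ≡ 4 * suc j * suc j + 4 * suc j + 2
    polynomial = solve-∀

-- For n = 4k the ladder has h = 2k columns, i.e. m = 2k − 3 = 2(k − 2) + 1; for n = 4k + 2, m = 2(k − 1).
mainTheorem6 : (k : ℕ)
    → (6 ≤ 4 * k → CountIs (4 * k) (4 * k * k + 2))
    × (6 ≤ 4 * k + 2 → CountIs (4 * k + 2) (4 * k * k + 4 * k + 2))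
mainTheorem6 k = n≡4k k , n≡4k+2 k
  where
  n≡4k : ∀ k → 6 ≤ 4 * k → CountIs (4 * k) (4 * k * k + 2)
  n≡4k (suc zero) (s≤s (s≤s (s≤s (s≤s ()))))
  n≡4k (suc (suc j)) _ = subst₂ CountIs (symbols j) (Counting.count-h-even j) (Rows.count-goodRows (suc (j + j)))
    where
    symbols : ∀ j → (4 + (j + j)) + (4 + (j + j)) ≡ 4 * (2 + j)
    symbols = solve-∀
  n≡4k+2 : ∀ k → 6 ≤ 4 * k + 2 → CountIs (4 * k + 2) (4 * k * k + 4 * k + 2)
  n≡4k+2 zero (s≤s (s≤s ()))
  n≡4k+2 (suc j) _ = subst₂ CountIs (symbols j) (Counting.count-h-odd j) (Rows.count-goodRows (j + j))
    where
    symbols : ∀ j → (3 + (j + j)) + (3 + (j + j)) ≡ 4 * (1 + j) + 2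
    symbols = solve-∀
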